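{- The logic $\mathrm{BD}_\infty$ (respectively $\mathrm{LP}_\infty$, $\mathrm{K}_\infty$, $\mathrm{CL}_\infty$) is complete as a finitary logic with respect to the family of structures $\boldsymbol{\mathcal{DM}}_n$ (respectively $\boldsymbol{\mathcal{P}}_n$, $\boldsymbol{\mathcal{K}}_n$, $\boldsymbol{\mathcal{B}}_n$), $n\ge1$; and $\mathrm{KO}_\infty$ is complete as a finitary logic with respect to the family of structures $\boldsymbol{\mathcal{P}}_i\otimes\boldsymbol{\mathcal{K}}_j$ ($i,j\ge0$, $i+j\ge1$). That is, a finitary rule (finite set of premises) is valid in the logic if and only if it is valid in every structure of the corresponding family.
   Context: Formulas are built from variables using $\wedge,\vee,\neg$. A structure is a pair $\langle\mathbf{A},F\rangle$, $F\subseteq A$; a rule $\Gamma\vdash\varphi$ is valid in it if every homomorphism $v$ from the formula algebra with $v[\Gamma]\subseteq F$ has $v(\varphi)\in F$. A logic is a substitution-invariant consequence relation; the extension of a logic by rules is the smallest logic containing it and those rules. $\mathrm{BD}_\infty$ is the logic determined by all structures $\langle\mathbf{A},F\rangle$ with $\mathbf{A}$ a De~Morgan lattice (distributive lattice with $\neg$ satisfying $\neg\neg x=x$ and De~Morgan laws) and $F$ an upset. $\mathrm{LP}_\infty$: extension of $\mathrm{BD}_\infty$ by $\emptyset\vdash x\vee\neg x$ and $x\vdash x\wedge(y\vee\neg y)$; $\mathrm{K}_\infty$: by $(x\wedge\neg x)\vee y\vdash y$; $\mathrm{CL}_\infty$: by all three; $\mathrm{KO}_\infty$: by $((x\wedge\neg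 x)\wedge z)\vee u\vdash((y\vee\neg y)\wedge z)\vee u$. $\mathbf{DM}_1$: four-element De~Morgan lattice on $\{\mathsf f,\mathsf n,\mathsf b,\mathsf t\}$, $\mathsf f<\mathsf n,\mathsf b<\mathsf t$, $\mathsf n,\mathsf b$ incomparable, $\neg\mathsf t=\mathsf f$, $\neg\mathsf n=\mathsf n$, $\neg\mathsf b=\mathsf b$. $\boldsymbol{\mathcal{DM}}_1=\langle\mathbf{DM}_1,\{\mathsf t,\mathsf b\}\rangle$; $\boldsymbol{\mathcal{P}}_1,\boldsymbol{\mathcal{K}}_1,\boldsymbol{\mathcal{B}}_1$ are its substructures on $\{\mathsf t,\mathsf b,\mathsf f\}$, $\{\mathsf t,\mathsf n,\mathsf f\}$, $\{\mathsf t,\mathsf f\}$ with designated sets $\{\mathsf t,\mathsf b\},\{\mathsf t\},\{\mathsf t\}$. Dual product: $\langle\prod\mathbf{A}_k,\bigcup_k\pi_k^{ -1}[F_k]\rangle$; $\boldsymbol{\mathcal{DM}}_n$ etc. are $n$-fold dual powers, and $\boldsymbol{\mathcal{P}}_i\otimes\boldsymbol{\mathcal{K}}_j$ is the dual product of $i$ copies of $\boldsymbol{\mathcal{P}}_1$ and $j$ copies of $\boldsymbol{\mathcal{K}}_1$. -}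

module Defs where

open import Level using (Level; 0ℓ) renaming (suc to lsuc)
open import Data.Nat using (ℕ; zero; suc)
open import Data.Fin using (Fin)
open import Data.Bool using (Bool; true; false; T)
open import Data.Unit using (⊤; tt)
open import Data.Product using (Σ; _×_; _,_; proj₁; proj₂; ∃)
open import Data.Sum using (_⊎_; inj₁; inj₂) renaming ([_,_] to case⊎)
open import Data.List using (List; []; _∷_)
open import Data.List.Membership.Propositional using (_∈_)
open import Relation.Binary.PropositionalEquality using (_≡_)

infixr 6 _∧'_
infixr 5 _∨'_

data Form : Set where
  var  : ℕ → Form
  _∧'_ : Form → Form → Form
  _∨'_ : Form → Form → Form
  ¬'_  : Form → Form

Subst : Set
Subst = ℕ → Form

sub : Subst → Form → Form
sub σ (var i)   = σ i
sub σ (φ ∧' ψ)  = sub σ φ ∧' sub σ ψ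
sub σ (φ ∨' ψ)  = sub σ φ ∨' sub σ ψ
sub σ (¬' φ)    = ¬' sub σ φ

FSet : Set₁
FSet = Form → Set

img : Subst → FSet → FSet
img σ Γ = λ ψ → Σ Form λ χ → Γ χ × (ψ ≡ sub σ χ)

⟦_⟧ : List Form → FSet
⟦ Γ ⟧ = λ ψ → ψ ∈ Γ

record Structure : Set₁ where
  field
    Carrier : Set
    _⊓_     : Carrier → Carrier → Carrier
    _⊔_     : Carrier → Carrier → Carrier
    neg     : Carrier → Carrier
    Des     : Carrier → Set

  eval : (ℕ → Carrier) → Form → Carrier
  eval v (var i)  = v i
  eval v (φ ∧' ψ) = eval v φ ⊓ eval v ψ
  eval v (φ ∨' ψ) = eval v φ ⊔ eval v ψ
  eval v (¬' φ)   = neg (eval v φ)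

ValidIn : Structure → FSet → Form → Set
ValidIn M Γ φ = ∀ (v : ℕ → Carrier) →
  (∀ ψ → Γ ψ → Des (eval v ψ)) → Des (eval v φ)
  where open Structure M

record DeMorganLattice : Set₁ where
  field
    Carrier : Set
    _⊓_     : Carrier → Carrier → Carrier
    _⊔_     : Carrier → Carrier → Carrier
    neg     : Carrier → Carrier
    ⊓-comm   : ∀ x y → x ⊓ y ≡ y ⊓ x
    ⊔-comm   : ∀ x y → x ⊔ y ≡ y ⊔ x
    ⊓-assoc  : ∀ x y z → (x ⊓ y) ⊓ z ≡ x ⊓ (y ⊓ z)
    ⊔-assoc  : ∀ x y z → (x ⊔ y) ⊔ z ≡ x ⊔ (y ⊔ z)
    ⊓-absorbs-⊔ : ∀ x y → x ⊓ (x ⊔ y) ≡ x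
    ⊔-absorbs-⊓ : ∀ x y → x ⊔ (x ⊓ y) ≡ x
    ⊓-distrib-⊔ : ∀ x y z → x ⊓ (y ⊔ z) ≡ (x ⊓ y) ⊔ (x ⊓ z)
    neg-invol  : ∀ x → neg (neg x) ≡ x
    neg-⊓      : ∀ x y → neg (x ⊓ y) ≡ neg x ⊔ neg y
    neg-⊔      : ∀ x y → neg (x ⊔ y) ≡ neg x ⊓ neg y

  _≤_ : Carrier → Carrier → Set
  x ≤ y = x ⊓ y ≡ x

IsUpset : (A : DeMorganLattice) → (DeMorganLattice.Carrier A → Set) → Set
IsUpset A F = ∀ x y → x ≤ y → F x → F y
  where open DeMorganLattice A

toStructure : (A : DeMorganLattice) → (DeMorganLattice.Carrier A → Set) → Structure
toStructure A F = record
  { Carrier = Carrier ; _⊓_ = _⊓_ ; _⊔_ = _⊔_ ; neg = neg ; Des = F }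
  where open DeMorganLattice A

Rel : Set₂
Rel = FSet → Form → Set₁

BD∞ : Rel
BD∞ Γ φ = ∀ (A : DeMorganLattice) (F : DeMorganLattice.Carrier A → Set) →
  IsUpset A F → ValidIn (toStructure A F) Γ φ

record IsLogic (L : FSet → Form → Set) : Set₁ where
  field
    reflexive : ∀ Γ φ → Γ φ → L Γ φ
    monotone  : ∀ Γ Δ φ → (∀ ψ → Γ ψ → Δ ψ) → L Γ φ → L Δ φ
    cut       : ∀ Γ Δ φ → (∀ ψ → Γ ψ → L Δ ψ) → L Γ φ → L Δ φ
    structural : ∀ (σ : Subst) Γ φ → L Γ φ → L (img σ Γ) (sub σ φ)

record Rule : Set where
  constructor _⊢_
  field
    premises   : List Form
    conclusion : Form

Extension : Rel → List Rule → Rel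
Extension Base R Γ φ =
  ∀ (L : FSet → Form → Set) → IsLogic L →
  (∀ Δ ψ → Base Δ ψ → L Δ ψ) →
  (∀ r → r ∈ R → L ⟦ Rule.premises r ⟧ (Rule.conclusion r)) →
  L Γ φ

x y z u : Form
x = var 0
y = var 1
z = var 2
u = var 3

rule-em : Rule
rule-em = [] ⊢ (x ∨' ¬' x)

rule-lp : Rule
rule-lp = (x ∷ []) ⊢ (x ∧' (y ∨' ¬' y))

rule-k : Rule
rule-k = (((x ∧' ¬' x) ∨' y) ∷ []) ⊢ y

rule-ko : Rule
rule-ko = ((((x ∧' ¬' x) ∧' z) ∨' u) ∷ []) ⊢ (((y ∨' ¬' y) ∧' z) ∨' u)

LP∞ K∞ CL∞ KO∞ : Rel
LP∞ = Extension BD∞ (rule-em ∷ rule-lp ∷ [])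
K∞  = Extension BD∞ (rule-k ∷ [])
CL∞ = Extension BD∞ (rule-em ∷ rule-lp ∷ rule-k ∷ [])
KO∞ = Extension BD∞ (rule-ko ∷ [])

data DM4 : Set where
  f n b t : DM4

_∧₄_ : DM4 → DM4 → DM4
f ∧₄ _ = f
t ∧₄ a = a
n ∧₄ f = f
n ∧₄ n = n
n ∧₄ b = f
n ∧₄ t = n
b ∧₄ f = f
b ∧₄ n = f
b ∧₄ b = b
b ∧₄ t = b

_∨₄_ : DM4 → DM4 → DM4
t ∨₄ _ = t
f ∨₄ a = a
n ∨₄ f = n
n ∨₄ n = n
n ∨₄ b = t
n ∨₄ t = t
b ∨₄ f = b
b ∨₄ n = t
b ∨₄ b = b
b ∨₄ t = t

¬₄ : DM4 → DM4
¬₄ f = t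
¬₄ n = n
¬₄ b = b
¬₄ t = f

D₁ : DM4 → Set
D₁ t = ⊤
D₁ b = ⊤
D₁ _ = Data.Empty.⊥
  where import Data.Empty

𝒟ℳ₁ : Structure
𝒟ℳ₁ = record { Carrier = DM4 ; _⊓_ = _∧₄_ ; _⊔_ = _∨₄_ ; neg = ¬₄ ; Des = D₁ }

record SubUniverse : Set where
  field
    mem  : DM4 → Bool
    cl-∧ : ∀ a c → T (mem a) → T (mem c) → T (mem (a ∧₄ c))
    cl-∨ : ∀ a c → T (mem a) → T (mem c) → T (mem (a ∨₄ c))
    cl-¬ : ∀ a → T (mem a) → T (mem (¬₄ a))

Sub𝒟ℳ₁ : SubUniverse → Structure
Sub𝒟ℳ₁ S = record
  { Carrier = Σ DM4 (λ a → T (mem a))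
  ; _⊓_ = λ p q → (proj₁ p ∧₄ proj₁ q) , cl-∧ (proj₁ p) (proj₁ q) (proj₂ p) (proj₂ q)
  ; _⊔_ = λ p q → (proj₁ p ∨₄ proj₁ q) , cl-∨ (proj₁ p) (proj₁ q) (proj₂ p) (proj₂ q)
  ; neg = λ p → ¬₄ (proj₁ p) , cl-¬ (proj₁ p) (proj₂ p)
  ; Des = λ p → D₁ (proj₁ p)
  }
  where open SubUniverse S

memP : DM4 → Bool
memP n = false
memP _ = true

memK : DM4 → Bool
memK b = false
memK _ = true

memB : DM4 → Bool
memB n = false
memB b = false
memB _ = true

SubP : SubUniverse
SubP = record { mem = memP ; cl-∧ = c∧ ; cl-∨ = c∨ ; cl-¬ = c¬ }
  where
  c∧ : ∀ a c → T (memP a) → T (memP c) → T (memP (a ∧₄ c))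
  c∧ n _ () _
  c∧ _ n _ ()
  c∧ f f _ _ = tt
  c∧ f b _ _ = tt
  c∧ f t _ _ = tt
  c∧ b f _ _ = tt
  c∧ b b _ _ = tt
  c∧ b t _ _ = tt
  c∧ t f _ _ = tt
  c∧ t b _ _ = tt
  c∧ t t _ _ = tt
  c∨ : ∀ a c → T (memP a) → T (memP c) → T (memP (a ∨₄ c))
  c∨ n _ () _
  c∨ _ n _ ()
  c∨ f f _ _ = tt
  c∨ f b _ _ = tt
  c∨ f t _ _ = tt
  c∨ b f _ _ = tt
  c∨ b b _ _ = tt
  c∨ b t _ _ = tt
  c∨ t f _ _ = tt
  c∨ t b _ _ = tt
  c∨ t t _ _ = tt
  c¬ : ∀ a → T (memP a) → T (memP (¬₄ a))
  c¬ n ()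
  c¬ f _ = tt
  c¬ b _ = tt
  c¬ t _ = tt

SubK : SubUniverse
SubK = record { mem = memK ; cl-∧ = c∧ ; cl-∨ = c∨ ; cl-¬ = c¬ }
  where
  c∧ : ∀ a c → T (memK a) → T (memK c) → T (memK (a ∧₄ c))
  c∧ b _ () _
  c∧ _ b _ ()
  c∧ f f _ _ = tt
  c∧ f n _ _ = tt
  c∧ f t _ _ = tt
  c∧ n f _ _ = tt
  c∧ n n _ _ = tt
  c∧ n t _ _ = tt
  c∧ t f _ _ = tt
  c∧ t n _ _ = tt
  c∧ t t _ _ = tt
  c∨ : ∀ a c → T (memK a) → T (memK c) → T (memK (a ∨₄ c))
  c∨ b _ () _
  c∨ _ b _ ()
  c∨ f f _ _ = tt
  c∨ f n _ _ = tt
  c∨ f t _ _ = tt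
  c∨ n f _ _ = tt
  c∨ n n _ _ = tt
  c∨ n t _ _ = tt
  c∨ t f _ _ = tt
  c∨ t n _ _ = tt
  c∨ t t _ _ = tt
  c¬ : ∀ a → T (memK a) → T (memK (¬₄ a))
  c¬ b ()
  c¬ f _ = tt
  c¬ n _ = tt
  c¬ t _ = tt

SubB : SubUniverse
SubB = record { mem = memB ; cl-∧ = c∧ ; cl-∨ = c∨ ; cl-¬ = c¬ }
  where
  c∧ : ∀ a c → T (memB a) → T (memB c) → T (memB (a ∧₄ c))
  c∧ n _ () _
  c∧ b _ () _
  c∧ _ n _ ()
  c∧ _ b _ ()
  c∧ f f _ _ = tt
  c∧ f t _ _ = tt
  c∧ t f _ _ = tt
  c∧ t t _ _ = tt
  c∨ : ∀ a c → T (memB a) → T (memB c) → T (memB (a ∨₄ c))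
  c∨ n _ () _
  c∨ b _ () _
  c∨ _ n _ ()
  c∨ _ b _ ()
  c∨ f f _ _ = tt
  c∨ f t _ _ = tt
  c∨ t f _ _ = tt
  c∨ t t _ _ = tt
  c¬ : ∀ a → T (memB a) → T (memB (¬₄ a))
  c¬ n ()
  c¬ b ()
  c¬ f _ = tt
  c¬ t _ = tt

𝒫₁ 𝒦₁ ℬ₁ : Structure
𝒫₁ = Sub𝒟ℳ₁ SubP
𝒦₁ = Sub𝒟ℳ₁ SubK
ℬ₁ = Sub𝒟ℳ₁ SubB

DualProduct : (I : Set) → (I → Structure) → Structure
DualProduct I M = record
  { Carrier = (k : I) → Structure.Carrier (M k)
  ; _⊓_ = λ p q k → Structure._⊓_ (M k) (p k) (q k)
  ; _⊔_ = λ p q k → Structure._⊔_ (M k) (p k) (q k)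
  ; neg = λ p k → Structure.neg (M k) (p k)
  ; Des = λ p → Σ I (λ k → Structure.Des (M k) (p k))
  }

DualPower : Structure → ℕ → Structure
DualPower M m = DualProduct (Fin m) (λ _ → M)

𝒟ℳ 𝒫 𝒦 ℬ : ℕ → Structure
𝒟ℳ = DualPower 𝒟ℳ₁
𝒫  = DualPower 𝒫₁
𝒦  = DualPower 𝒦₁
ℬ  = DualPower ℬ₁

𝒫⊗𝒦 : ℕ → ℕ → Structure
𝒫⊗𝒦 i j = DualProduct (Fin i ⊎ Fin j) (case⊎ (λ _ → 𝒫₁) (λ _ → 𝒦₁))

{-# OPTIONS --safe #-}
-- Each one-element structure embeds strictly into 𝒟ℳ₁, so a finite dual product
-- of them embeds strictly into ⟨DM4ᴺ, {x ∣ some xⱼ ∈ {t, b}}⟩, whose designated set is an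
-- upset; hence BD∞ is sound for it.  The additional rules have at most one premise, and such
-- rules pass from the factors to a dual product coordinatewise.
--
-- For a single premise γ, put γ (for LP∞, CL∞ and KO∞: γ together with the
-- excluded-middle instances of the variables of φ) into disjunctive normal form.  If every
-- clause entails φ by monotonicity alone, or is inconsistent where the logic discards
-- contradictions, then γ ⊢ φ is derivable; otherwise a failing clause, read as a Belnap
-- valuation, designates γ but not φ in the appropriate one-element structure.  For several
-- premises, either one of them already derives φ, or their countermodels, together with one
-- refuting φ outright, are the coordinates of a countermodel in a dual product, which
-- designates an element as soon as one coordinate does.
module Submission where

open import Defs
open import Level using (0ℓ)
import Algebra.Lattice.Properties.Lattice as AlgebraicLatticeProperties
import Relation.Binary.Lattice as OrderLattice
open import Data.Bool using (Bool; true; false; T; not)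
import Data.Bool as Bool
open import Data.Empty using (⊥-elim)
open import Data.Fin using (Fin; zero; suc)
open import Data.Fin.Properties using (+↔⊎)
open import Data.List using (List; []; _∷_; _++_; map; length; lookup; cartesianProductWith)
open import Data.List.Membership.Propositional using (_∈_; find; lose)
open import Data.List.Membership.Propositional.Properties
  using (∈-++⁺ˡ; ∈-++⁺ʳ; ∈-++⁻; ∈-map⁺; ∈-lookup; ∈-cartesianProductWith⁺; ∈-cartesianProductWith⁻)
open import Data.List.Relation.Binary.Subset.Propositional using (_⊆_)
open import Data.List.Relation.Binary.Subset.Propositional.Properties using (xs⊆xs++ys; xs⊆ys++xs)
open import Data.List.Relation.Unary.All as All using (All; []; _∷_; all?)
open import Data.List.Relation.Unary.All.Properties using (¬All⇒Any¬)
open import Data.List.Relation.Unary.Any using (Any; here; there; index; any?)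
open import Data.List.Relation.Unary.Any.Properties using (lookup-index)
open import Data.Nat using (ℕ; zero; suc; _+_; _≤_; s≤s; z≤n)
import Data.Nat as ℕ
open import Data.Nat.Properties using (≤-trans; m≤n+m)
open import Data.Product using (Σ-syntax; ∃-syntax; _×_; _,_; proj₁; proj₂)
open import Data.Product.Properties using (≡-dec)
open import Data.Sum using (_⊎_; inj₁; inj₂; [_,_]′)
import Data.Sum as Sum
open import Data.Unit using (⊤; tt)
open import Function using (_∘_; _↔_; Inverse; _⇔_; mk⇔)
open import Function.Properties.Inverse using (↔-refl)
open import Relation.Binary.PropositionalEquality
  using (_≡_; refl; sym; trans; cong; cong₂; subst; isEquivalence; module ≡-Reasoning)
open import Relation.Nullary using (¬_; Dec; yes; no)
open import Relation.Nullary.Decidable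
  using (toWitness; map′; toSum; _×-dec_; _⊎-dec_; _→-dec_; T?)
open import Relation.Unary using (Decidable)
open import Data.List.Membership.DecPropositional (≡-dec ℕ._≟_ Bool._≟_) using (_∈?_)

infix 4 _≟₄_

_≟₄_ : (a c : DM4) → Dec (a ≡ c)
f ≟₄ f = yes refl
f ≟₄ n = no λ ()
f ≟₄ b = no λ ()
f ≟₄ t = no λ ()
n ≟₄ f = no λ ()
n ≟₄ n = yes refl
n ≟₄ b = no λ ()
n ≟₄ t = no λ ()
b ≟₄ f = no λ ()
b ≟₄ n = no λ ()
b ≟₄ b = yes refl
b ≟₄ t = no λ ()
t ≟₄ f = no λ ()
t ≟₄ n = no λ ()
t ≟₄ b = no λ ()
t ≟₄ t = yes refl

D₁? : Decidable D₁
D₁? f = no λ ()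
D₁? n = no λ ()
D₁? b = yes tt
D₁? t = yes tt

∀₄? : {P : DM4 → Set} → Decidable P → Dec (∀ a → P a)
∀₄? P? = map′ (λ (pf , pn , pb , pt) → λ { f → pf ; n → pn ; b → pb ; t → pt })
              (λ all → all f , all n , all b , all t)
              (P? f ×-dec P? n ×-dec P? b ×-dec P? t)

∀₄²? : {P : DM4 → DM4 → Set} → (∀ a c → Dec (P a c)) → Dec (∀ a c → P a c)
∀₄²? P? = ∀₄? λ a → ∀₄? (P? a)

∀₄³? : {P : DM4 → DM4 → DM4 → Set} → (∀ a c d → Dec (P a c d)) → Dec (∀ a c d → P a c d)
∀₄³? P? = ∀₄? λ a → ∀₄²? (P? a)

DM4-lattice : DeMorganLattice
DM4-lattice = record
  { Carrier     = DM4
  ; _⊓_         = _∧₄_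
  ; _⊔_         = _∨₄_
  ; neg         = ¬₄
  ; ⊓-comm      = toWitness {a? = ∀₄²? λ _ _ → _ ≟₄ _} tt
  ; ⊔-comm      = toWitness {a? = ∀₄²? λ _ _ → _ ≟₄ _} tt
  ; ⊓-assoc     = toWitness {a? = ∀₄³? λ _ _ _ → _ ≟₄ _} tt
  ; ⊔-assoc     = toWitness {a? = ∀₄³? λ _ _ _ → _ ≟₄ _} tt
  ; ⊓-absorbs-⊔ = toWitness {a? = ∀₄²? λ _ _ → _ ≟₄ _} tt
  ; ⊔-absorbs-⊓ = toWitness {a? = ∀₄²? λ _ _ → _ ≟₄ _} tt
  ; ⊓-distrib-⊔ = toWitness {a? = ∀₄³? λ _ _ _ → _ ≟₄ _} tt
  ; neg-invol   = toWitness {a? = ∀₄? λ _ → _ ≟₄ _} tt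
  ; neg-⊓       = toWitness {a? = ∀₄²? λ _ _ → _ ≟₄ _} tt
  ; neg-⊔       = toWitness {a? = ∀₄²? λ _ _ → _ ≟₄ _} tt
  }

D₁-upset : IsUpset DM4-lattice D₁
D₁-upset = toWitness {a? = ∀₄²? λ _ _ → (_ ≟₄ _) →-dec D₁? _ →-dec D₁? _} tt

D₁-∧⁻ : ∀ a c → D₁ (a ∧₄ c) → D₁ a × D₁ c
D₁-∧⁻ = toWitness {a? = ∀₄²? λ _ _ → D₁? _ →-dec D₁? _ ×-dec D₁? _} tt

D₁-∧⁺ : ∀ a c → D₁ a → D₁ c → D₁ (a ∧₄ c)
D₁-∧⁺ = toWitness {a? = ∀₄²? λ _ _ → D₁? _ →-dec D₁? _ →-dec D₁? _} tt

D₁-∨⁻ : ∀ a c → D₁ (a ∨₄ c) → D₁ a ⊎ D₁ c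
D₁-∨⁻ = toWitness {a? = ∀₄²? λ _ _ → D₁? _ →-dec (D₁? _ ⊎-dec D₁? _)} tt

D₁-∨⁺ : ∀ a c → D₁ a ⊎ D₁ c → D₁ (a ∨₄ c)
D₁-∨⁺ = toWitness {a? = ∀₄²? λ _ _ → (D₁? _ ⊎-dec D₁? _) →-dec D₁? _} tt

vars : Form → List ℕ
vars (var p)  = p ∷ []
vars (φ ∧' ψ) = vars φ ++ vars ψ
vars (φ ∨' ψ) = vars φ ++ vars ψ
vars (¬' φ)   = vars φ

module _ (M : Structure) where
  open Structure M

  eval-sub : ∀ v σ φ → eval v (sub σ φ) ≡ eval (λ i → eval v (σ i)) φ
  eval-sub v σ (var i)  = refl
  eval-sub v σ (φ ∧' ψ) = cong₂ _⊓_ (eval-sub v σ φ) (eval-sub v σ ψ)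
  eval-sub v σ (φ ∨' ψ) = cong₂ _⊔_ (eval-sub v σ φ) (eval-sub v σ ψ)
  eval-sub v σ (¬' φ)   = cong neg (eval-sub v σ φ)

  eval-cong : ∀ {v w} φ → (∀ p → p ∈ vars φ → v p ≡ w p) → eval v φ ≡ eval w φ
  eval-cong (var p)  agree = agree p (here refl)
  eval-cong (φ ∧' ψ) agree =
    cong₂ _⊓_ (eval-cong φ (λ p → agree p ∘ ∈-++⁺ˡ)) (eval-cong ψ (λ p → agree p ∘ ∈-++⁺ʳ (vars φ)))
  eval-cong (φ ∨' ψ) agree =
    cong₂ _⊔_ (eval-cong φ (λ p → agree p ∘ ∈-++⁺ˡ)) (eval-cong ψ (λ p → agree p ∘ ∈-++⁺ʳ (vars φ)))
  eval-cong (¬' φ)   agree = cong neg (eval-cong φ agree)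

  ValidIn-isLogic : IsLogic (ValidIn M)
  ValidIn-isLogic = record
    { reflexive  = λ _ _ φ∈Γ v hyp → hyp _ φ∈Γ
    ; monotone   = λ _ _ _ Γ⊆Δ valid v hyp → valid v (λ ψ → hyp ψ ∘ Γ⊆Δ ψ)
    ; cut        = λ _ _ _ Δ⊢Γ valid v hyp → valid v (λ ψ ψ∈Γ → Δ⊢Γ ψ ψ∈Γ v hyp)
    ; structural = λ σ _ φ valid v hyp → subst Des (sym (eval-sub v σ φ))
        (valid (λ i → eval v (σ i)) λ χ χ∈Γ → subst Des (eval-sub v σ χ) (hyp (sub σ χ) (χ , χ∈Γ , refl)))
    }

record Countermodel (M : Structure) (Γ : FSet) (φ : Form) : Set where
  open Structure M
  field
    valuation  : ℕ → Carrier
    designates : ∀ γ → Γ γ → Des (eval valuation γ)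
    refutes    : ¬ Des (eval valuation φ)

Countermodel⇒¬ValidIn : ∀ {M Γ φ} → Countermodel M Γ φ → ¬ ValidIn M Γ φ
Countermodel⇒¬ValidIn c valid = refutes (valid valuation designates)
  where open Countermodel c

Countermodel-antitone : ∀ {M Γ Δ φ} → (∀ ψ → Δ ψ → Γ ψ) → Countermodel M Γ φ → Countermodel M Δ φ
Countermodel-antitone Δ⊆Γ c = record
  { valuation = valuation ; designates = λ ψ → designates ψ ∘ Δ⊆Γ ψ ; refutes = refutes }
  where open Countermodel c

single : ∀ {P : Form → Set} {γ} → P γ → ∀ ψ → ⟦ γ ∷ [] ⟧ ψ → P ψ
single Pγ _ (here refl) = Pγ

module _ {I : Set} (M : I → Structure) where
  open Structure using (eval; Des)

  eval-DualProduct : ∀ v φ k → eval (DualProduct I M) v φ k ≡ eval (M k) (λ i → v i k) φ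
  eval-DualProduct v (var i)  k = refl
  eval-DualProduct v (φ ∧' ψ) k =
    cong₂ (Structure._⊓_ (M k)) (eval-DualProduct v φ k) (eval-DualProduct v ψ k)
  eval-DualProduct v (φ ∨' ψ) k =
    cong₂ (Structure._⊔_ (M k)) (eval-DualProduct v φ k) (eval-DualProduct v ψ k)
  eval-DualProduct v (¬' φ)   k = cong (Structure.neg (M k)) (eval-DualProduct v φ k)

  DualProduct-countermodel : ∀ {Δ : I → FSet} {Γ φ} → (∀ k → Countermodel (M k) (Δ k) φ) →
    (∀ γ → Γ γ → ∃[ k ] Δ k γ) → Countermodel (DualProduct I M) Γ φ
  DualProduct-countermodel {φ = φ} c cover = record
    { valuation  = v
    ; designates = λ γ γ∈Γ → let k , γ∈Δ = cover γ γ∈Γ in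
        k , subst (Des (M k)) (sym (eval-DualProduct v γ k)) (Countermodel.designates (c k) γ γ∈Δ)
    ; refutes    = λ (k , d) → Countermodel.refutes (c k) (subst (Des (M k)) (eval-DualProduct v φ k) d)
    }
    where
    v : ℕ → Structure.Carrier (DualProduct I M)
    v i k = Countermodel.valuation (c k) i

  DualProduct-valid₀ : ∀ {φ} → I → (∀ k → ValidIn (M k) ⟦ [] ⟧ φ) → ValidIn (DualProduct I M) ⟦ [] ⟧ φ
  DualProduct-valid₀ {φ} k valid v _ =
    k , subst (Des (M k)) (sym (eval-DualProduct v φ k)) (valid k (λ i → v i k) λ _ ())

  DualProduct-valid₁ : ∀ {γ φ} → (∀ k → ValidIn (M k) ⟦ γ ∷ [] ⟧ φ) → ValidIn (DualProduct I M) ⟦ γ ∷ [] ⟧ φ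
  DualProduct-valid₁ {γ} {φ} valid v hyp =
    let k , d = hyp γ (here refl) in
    k , subst (Des (M k)) (sym (eval-DualProduct v φ k))
          (valid k (λ i → v i k) (single (subst (Des (M k)) (eval-DualProduct v γ k) d)))

record StrictHom (M N : Structure) : Set where
  private
    module M = Structure M
    module N = Structure N
  field
    h      : M.Carrier → N.Carrier
    h-⊓    : ∀ a c → h (a M.⊓ c) ≡ h a N.⊓ h c
    h-⊔    : ∀ a c → h (a M.⊔ c) ≡ h a N.⊔ h c
    h-neg  : ∀ a → h (M.neg a) ≡ N.neg (h a)
    h-Des  : ∀ a → M.Des a → N.Des (h a)
    h-Des⁻ : ∀ a → N.Des (h a) → M.Des a

module _ {M N : Structure} (H : StrictHom M N) where
  open StrictHom H
  open Structure using (eval; Des)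

  eval-hom : ∀ v φ → h (eval M v φ) ≡ eval N (h ∘ v) φ
  eval-hom v (var i)  = refl
  eval-hom v (φ ∧' ψ) = trans (h-⊓ _ _) (cong₂ (Structure._⊓_ N) (eval-hom v φ) (eval-hom v ψ))
  eval-hom v (φ ∨' ψ) = trans (h-⊔ _ _) (cong₂ (Structure._⊔_ N) (eval-hom v φ) (eval-hom v ψ))
  eval-hom v (¬' φ)   = trans (h-neg _) (cong (Structure.neg N) (eval-hom v φ))

  ValidIn-reflect : ∀ {Γ φ} → ValidIn N Γ φ → ValidIn M Γ φ
  ValidIn-reflect {φ = φ} valid v hyp = h-Des⁻ _ (subst (Des N) (sym (eval-hom v φ))
    (valid (h ∘ v) λ γ γ∈Γ → subst (Des N) (eval-hom v γ) (h-Des _ (hyp γ γ∈Γ))))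

  Countermodel-pullback : ∀ {Γ φ} (v : ℕ → Structure.Carrier M) →
    (∀ γ → Γ γ → Des N (eval N (h ∘ v) γ)) → ¬ Des N (eval N (h ∘ v) φ) → Countermodel M Γ φ
  Countermodel-pullback {φ = φ} v designates refutes = record
    { valuation  = v
    ; designates = λ γ γ∈Γ → h-Des⁻ _ (subst (Des N) (sym (eval-hom v γ)) (designates γ γ∈Γ))
    ; refutes    = refutes ∘ subst (Des N) (eval-hom v φ) ∘ h-Des _
    }

Sub-inclusion : ∀ S → StrictHom (Sub𝒟ℳ₁ S) 𝒟ℳ₁
Sub-inclusion S = record
  { h = proj₁ ; h-⊓ = λ _ _ → refl ; h-⊔ = λ _ _ → refl ; h-neg = λ _ → refl
  ; h-Des = λ _ d → d ; h-Des⁻ = λ _ d → d }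

𝒟ℳ₁-identity : StrictHom 𝒟ℳ₁ 𝒟ℳ₁
𝒟ℳ₁-identity = record
  { h = λ a → a ; h-⊓ = λ _ _ → refl ; h-⊔ = λ _ _ → refl ; h-neg = λ _ → refl
  ; h-Des = λ _ d → d ; h-Des⁻ = λ _ d → d }

Countermodel-Sub : ∀ S {Γ φ} (c : Countermodel 𝒟ℳ₁ Γ φ) →
  (∀ p → T (SubUniverse.mem S (Countermodel.valuation c p))) → Countermodel (Sub𝒟ℳ₁ S) Γ φ
Countermodel-Sub S c ∈S =
  Countermodel-pullback (Sub-inclusion S) (λ p → valuation p , ∈S p) designates refutes
  where open Countermodel c

𝟙ᴸ : DeMorganLattice
𝟙ᴸ = record
  { Carrier = ⊤ ; _⊓_ = λ _ _ → tt ; _⊔_ = λ _ _ → tt ; neg = λ _ → tt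
  ; ⊓-comm = λ _ _ → refl ; ⊔-comm = λ _ _ → refl ; ⊓-assoc = λ _ _ _ → refl ; ⊔-assoc = λ _ _ _ → refl
  ; ⊓-absorbs-⊔ = λ _ _ → refl ; ⊔-absorbs-⊓ = λ _ _ → refl ; ⊓-distrib-⊔ = λ _ _ _ → refl
  ; neg-invol = λ _ → refl ; neg-⊓ = λ _ _ → refl ; neg-⊔ = λ _ _ → refl }

_×ᴸ_ : DeMorganLattice → DeMorganLattice → DeMorganLattice
A ×ᴸ B = record
  { Carrier     = A.Carrier × B.Carrier
  ; _⊓_         = λ (x₁ , x₂) (y₁ , y₂) → x₁ A.⊓ y₁ , x₂ B.⊓ y₂
  ; _⊔_         = λ (x₁ , x₂) (y₁ , y₂) → x₁ A.⊔ y₁ , x₂ B.⊔ y₂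
  ; neg         = λ (x₁ , x₂) → A.neg x₁ , B.neg x₂
  ; ⊓-comm      = λ _ _ → cong₂ _,_ (A.⊓-comm _ _) (B.⊓-comm _ _)
  ; ⊔-comm      = λ _ _ → cong₂ _,_ (A.⊔-comm _ _) (B.⊔-comm _ _)
  ; ⊓-assoc     = λ _ _ _ → cong₂ _,_ (A.⊓-assoc _ _ _) (B.⊓-assoc _ _ _)
  ; ⊔-assoc     = λ _ _ _ → cong₂ _,_ (A.⊔-assoc _ _ _) (B.⊔-assoc _ _ _)
  ; ⊓-absorbs-⊔ = λ _ _ → cong₂ _,_ (A.⊓-absorbs-⊔ _ _) (B.⊓-absorbs-⊔ _ _)
  ; ⊔-absorbs-⊓ = λ _ _ → cong₂ _,_ (A.⊔-absorbs-⊓ _ _) (B.⊔-absorbs-⊓ _ _)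
  ; ⊓-distrib-⊔ = λ _ _ _ → cong₂ _,_ (A.⊓-distrib-⊔ _ _ _) (B.⊓-distrib-⊔ _ _ _)
  ; neg-invol   = λ _ → cong₂ _,_ (A.neg-invol _) (B.neg-invol _)
  ; neg-⊓       = λ _ _ → cong₂ _,_ (A.neg-⊓ _ _) (B.neg-⊓ _ _)
  ; neg-⊔       = λ _ _ → cong₂ _,_ (A.neg-⊔ _ _) (B.neg-⊔ _ _)
  }
  where
  module A = DeMorganLattice A
  module B = DeMorganLattice B

infixr 8 _^ᴸ_

_^ᴸ_ : DeMorganLattice → ℕ → DeMorganLattice
A ^ᴸ zero  = 𝟙ᴸ
A ^ᴸ suc N = A ×ᴸ (A ^ᴸ N)

module Power (A : DeMorganLattice) where
  open DeMorganLattice A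
  private
    module P (N : ℕ) = DeMorganLattice (A ^ᴸ N)

  lookupᴸ : ∀ {N} → Fin N → P.Carrier N → Carrier
  lookupᴸ zero    (x , _)  = x
  lookupᴸ (suc j) (_ , xs) = lookupᴸ j xs

  tabulateᴸ : ∀ {N} → (Fin N → Carrier) → P.Carrier N
  tabulateᴸ {zero}  g = tt
  tabulateᴸ {suc N} g = g zero , tabulateᴸ (g ∘ suc)

  lookup∘tabulate : ∀ {N} (g : Fin N → Carrier) j → lookupᴸ j (tabulateᴸ g) ≡ g j
  lookup∘tabulate g zero    = refl
  lookup∘tabulate g (suc j) = lookup∘tabulate (g ∘ suc) j

  lookup-⊓ : ∀ {N} (j : Fin N) x y → lookupᴸ j (P._⊓_ N x y) ≡ lookupᴸ j x ⊓ lookupᴸ j y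
  lookup-⊓ zero    _       _       = refl
  lookup-⊓ (suc j) (_ , x) (_ , y) = lookup-⊓ j x y

  tabulate-⊓ : ∀ {N} {g h k : Fin N → Carrier} → (∀ j → g j ≡ h j ⊓ k j) →
    tabulateᴸ g ≡ P._⊓_ N (tabulateᴸ h) (tabulateᴸ k)
  tabulate-⊓ {zero}  _  = refl
  tabulate-⊓ {suc N} eq = cong₂ _,_ (eq zero) (tabulate-⊓ (eq ∘ suc))

  tabulate-⊔ : ∀ {N} {g h k : Fin N → Carrier} → (∀ j → g j ≡ h j ⊔ k j) →
    tabulateᴸ g ≡ P._⊔_ N (tabulateᴸ h) (tabulateᴸ k)
  tabulate-⊔ {zero}  _  = refl
  tabulate-⊔ {suc N} eq = cong₂ _,_ (eq zero) (tabulate-⊔ (eq ∘ suc))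

  tabulate-neg : ∀ {N} {g h : Fin N → Carrier} → (∀ j → g j ≡ neg (h j)) →
    tabulateᴸ g ≡ P.neg N (tabulateᴸ h)
  tabulate-neg {zero}  _  = refl
  tabulate-neg {suc N} eq = cong₂ _,_ (eq zero) (tabulate-neg (eq ∘ suc))

  Somewhere : ∀ N → (Carrier → Set) → P.Carrier N → Set
  Somewhere N F x = Σ[ j ∈ Fin N ] F (lookupᴸ j x)

  Somewhere-upset : ∀ {F} N → IsUpset A F → IsUpset (A ^ᴸ N) (Somewhere N F)
  Somewhere-upset N up x y x≤y (j , Fxⱼ) =
    j , up _ _ (trans (sym (lookup-⊓ j x y)) (cong (lookupᴸ j) x≤y)) Fxⱼ

𝒫|𝒦 : ∀ {i j} → Fin i ⊎ Fin j → Structure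
𝒫|𝒦 = Sum.[ (λ _ → 𝒫₁) , (λ _ → 𝒦₁) ]

module _ {I : Set} {M : I → Structure} {N : ℕ} (ι : Fin N ↔ I) (H : ∀ k → StrictHom (M k) 𝒟ℳ₁) where
  open Inverse ι using (to; from; strictlyInverseˡ)
  open Power DM4-lattice
  private
    hₖ : ∀ k → Structure.Carrier (M k) → DM4
    hₖ k = StrictHom.h (H k)

    coordinates : Structure.Carrier (DualProduct I M) → Fin N → DM4
    coordinates p j = hₖ (to j) (p (to j))

  DualProduct→Power : StrictHom (DualProduct I M) (toStructure (DM4-lattice ^ᴸ N) (Somewhere N D₁))
  DualProduct→Power = record
    { h      = tabulateᴸ ∘ coordinates
    ; h-⊓    = λ _ _ → tabulate-⊓ λ j → StrictHom.h-⊓ (H (to j)) _ _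
    ; h-⊔    = λ _ _ → tabulate-⊔ λ j → StrictHom.h-⊔ (H (to j)) _ _
    ; h-neg  = λ _ → tabulate-neg λ j → StrictHom.h-neg (H (to j)) _
    ; h-Des  = λ p (k , d) → from k , subst D₁ (sym (lookup∘tabulate (coordinates p) (from k)))
        (subst (λ k′ → D₁ (hₖ k′ (p k′))) (sym (strictlyInverseˡ k)) (StrictHom.h-Des (H k) _ d))
    ; h-Des⁻ = λ p (j , d) →
        to j , StrictHom.h-Des⁻ (H (to j)) _ (subst D₁ (lookup∘tabulate (coordinates p) j) d)
    }

  BD∞-sound-DualProduct : ∀ Γ φ → BD∞ Γ φ → ValidIn (DualProduct I M) Γ φ
  BD∞-sound-DualProduct Γ φ bd = ValidIn-reflect DualProduct→Power {Γ} {φ}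
    (bd (DM4-lattice ^ᴸ N) (Somewhere N D₁) (Somewhere-upset N D₁-upset))

BD∞-sound-𝒟ℳ : ∀ m Γ φ → BD∞ Γ φ → ValidIn (𝒟ℳ m) Γ φ
BD∞-sound-𝒟ℳ m = BD∞-sound-DualProduct ↔-refl λ _ → 𝒟ℳ₁-identity

BD∞-sound-Sub : ∀ S m Γ φ → BD∞ Γ φ → ValidIn (DualPower (Sub𝒟ℳ₁ S) m) Γ φ
BD∞-sound-Sub S m = BD∞-sound-DualProduct ↔-refl λ _ → Sub-inclusion S

BD∞-sound-𝒫⊗𝒦 : ∀ i j Γ φ → BD∞ Γ φ → ValidIn (𝒫⊗𝒦 i j) Γ φ
BD∞-sound-𝒫⊗𝒦 i j = BD∞-sound-DualProduct +↔⊎ inclusion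
  where
  inclusion : ∀ k → StrictHom (𝒫|𝒦 k) 𝒟ℳ₁
  inclusion (inj₁ _) = Sub-inclusion SubP
  inclusion (inj₂ _) = Sub-inclusion SubK

polar : Bool → Form → Form
polar true  φ = φ
polar false φ = ¬' φ

Literal : Set
Literal = ℕ × Bool

lit : Literal → Form
lit (p , s) = polar s (var p)

Clause : Set
Clause = List Literal

infixr 5 _⊗_

_⊗_ : List Clause → List Clause → List Clause
_⊗_ = cartesianProductWith _++_

-- dnf s φ is a disjunctive normal form of polar s φ.
dnf : Bool → Form → List Clause
dnf s     (var p)  = ((p , s) ∷ []) ∷ []
dnf true  (φ ∧' ψ) = dnf true φ ⊗ dnf true ψ
dnf false (φ ∧' ψ) = dnf false φ ++ dnf false ψ
dnf true  (φ ∨' ψ) = dnf true φ ++ dnf true ψ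
dnf false (φ ∨' ψ) = dnf false φ ⊗ dnf false ψ
dnf s     (¬' φ)   = dnf (not s) φ

-- Covers C s φ: the conjunction of the literals of C entails polar s φ by monotonicity alone.
Covers : Clause → Bool → Form → Set
Covers C s     (var p)  = (p , s) ∈ C
Covers C true  (φ ∧' ψ) = Covers C true φ × Covers C true ψ
Covers C false (φ ∧' ψ) = Covers C false φ ⊎ Covers C false ψ
Covers C true  (φ ∨' ψ) = Covers C true φ ⊎ Covers C true ψ
Covers C false (φ ∨' ψ) = Covers C false φ × Covers C false ψ
Covers C s     (¬' φ)   = Covers C (not s) φ

covers? : ∀ C s φ → Dec (Covers C s φ)
covers? C s     (var p)  = (p , s) ∈? C
covers? C true  (φ ∧' ψ) = covers? C true φ ×-dec covers? C true ψ
covers? C false (φ ∧' ψ) = covers? C false φ ⊎-dec covers? C false ψ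
covers? C true  (φ ∨' ψ) = covers? C true φ ⊎-dec covers? C true ψ
covers? C false (φ ∨' ψ) = covers? C false φ ×-dec covers? C false ψ
covers? C s     (¬' φ)   = covers? C (not s) φ

Covers-mono : ∀ {C C′} → C ⊆ C′ → ∀ s φ → Covers C s φ → Covers C′ s φ
Covers-mono C⊆C′ s     (var p)  p∈C       = C⊆C′ p∈C
Covers-mono C⊆C′ true  (φ ∧' ψ) (cφ , cψ) = Covers-mono C⊆C′ true φ cφ , Covers-mono C⊆C′ true ψ cψ
Covers-mono C⊆C′ false (φ ∧' ψ) c         = Sum.map (Covers-mono C⊆C′ false φ) (Covers-mono C⊆C′ false ψ) c
Covers-mono C⊆C′ true  (φ ∨' ψ) c         = Sum.map (Covers-mono C⊆C′ true φ) (Covers-mono C⊆C′ true ψ) c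
Covers-mono C⊆C′ false (φ ∨' ψ) (cφ , cψ) = Covers-mono C⊆C′ false φ cφ , Covers-mono C⊆C′ false ψ cψ
Covers-mono C⊆C′ s     (¬' φ)   c         = Covers-mono C⊆C′ (not s) φ c

∈dnf⇒Covers : ∀ s φ {C} → C ∈ dnf s φ → Covers C s φ
∈dnf⇒Covers s (var p) (here refl) = here refl
∈dnf⇒Covers true (φ ∧' ψ) C∈ with ∈-cartesianProductWith⁻ _++_ (dnf true φ) (dnf true ψ) C∈
... | Cφ , Cψ , Cφ∈ , Cψ∈ , refl =
  Covers-mono (xs⊆xs++ys Cφ Cψ) true φ (∈dnf⇒Covers true φ Cφ∈) ,
  Covers-mono (xs⊆ys++xs Cψ Cφ) true ψ (∈dnf⇒Covers true ψ Cψ∈)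
∈dnf⇒Covers false (φ ∨' ψ) C∈ with ∈-cartesianProductWith⁻ _++_ (dnf false φ) (dnf false ψ) C∈
... | Cφ , Cψ , Cφ∈ , Cψ∈ , refl =
  Covers-mono (xs⊆xs++ys Cφ Cψ) false φ (∈dnf⇒Covers false φ Cφ∈) ,
  Covers-mono (xs⊆ys++xs Cψ Cφ) false ψ (∈dnf⇒Covers false ψ Cψ∈)
∈dnf⇒Covers false (φ ∧' ψ) C∈ =
  Sum.map (∈dnf⇒Covers false φ) (∈dnf⇒Covers false ψ) (∈-++⁻ (dnf false φ) C∈)
∈dnf⇒Covers true (φ ∨' ψ) C∈ =
  Sum.map (∈dnf⇒Covers true φ) (∈dnf⇒Covers true ψ) (∈-++⁻ (dnf true φ) C∈)
∈dnf⇒Covers s (¬' φ) C∈ = ∈dnf⇒Covers (not s) φ C∈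

∈dnf⇒∈vars : ∀ s φ {C p s′} → C ∈ dnf s φ → (p , s′) ∈ C → p ∈ vars φ
∈dnf⇒∈vars s (var p) (here refl) (here refl) = here refl
∈dnf⇒∈vars true (φ ∧' ψ) C∈ ℓ∈ with ∈-cartesianProductWith⁻ _++_ (dnf true φ) (dnf true ψ) C∈
... | Cφ , Cψ , Cφ∈ , Cψ∈ , refl with ∈-++⁻ Cφ ℓ∈
...   | inj₁ ℓ∈Cφ = ∈-++⁺ˡ (∈dnf⇒∈vars true φ Cφ∈ ℓ∈Cφ)
...   | inj₂ ℓ∈Cψ = ∈-++⁺ʳ (vars φ) (∈dnf⇒∈vars true ψ Cψ∈ ℓ∈Cψ)
∈dnf⇒∈vars false (φ ∨' ψ) C∈ ℓ∈ with ∈-cartesianProductWith⁻ _++_ (dnf false φ) (dnf false ψ) C∈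
... | Cφ , Cψ , Cφ∈ , Cψ∈ , refl with ∈-++⁻ Cφ ℓ∈
...   | inj₁ ℓ∈Cφ = ∈-++⁺ˡ (∈dnf⇒∈vars false φ Cφ∈ ℓ∈Cφ)
...   | inj₂ ℓ∈Cψ = ∈-++⁺ʳ (vars φ) (∈dnf⇒∈vars false ψ Cψ∈ ℓ∈Cψ)
∈dnf⇒∈vars false (φ ∧' ψ) C∈ ℓ∈ with ∈-++⁻ (dnf false φ) C∈
... | inj₁ C∈φ = ∈-++⁺ˡ (∈dnf⇒∈vars false φ C∈φ ℓ∈)
... | inj₂ C∈ψ = ∈-++⁺ʳ (vars φ) (∈dnf⇒∈vars false ψ C∈ψ ℓ∈)
∈dnf⇒∈vars true (φ ∨' ψ) C∈ ℓ∈ with ∈-++⁻ (dnf true φ) C∈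
... | inj₁ C∈φ = ∈-++⁺ˡ (∈dnf⇒∈vars true φ C∈φ ℓ∈)
... | inj₂ C∈ψ = ∈-++⁺ʳ (vars φ) (∈dnf⇒∈vars true ψ C∈ψ ℓ∈)
∈dnf⇒∈vars s (¬' φ) C∈ ℓ∈ = ∈dnf⇒∈vars (not s) φ C∈ ℓ∈

-- γ ∧EM ps adds to γ the excluded-middle instances of the variables ps, and clashesOr ps g u is
-- (⋁_{p ∈ ps} (p ∧ ¬p ∧ g)) ∨ u: the premise strengthening of LP∞ and the contradictions
-- discarded by K∞.
clash : ℕ → Form
clash p = var p ∧' ¬' var p

clashesOr : List ℕ → Form → Form → Form
clashesOr []       g u = u
clashesOr (p ∷ ps) g u = (clash p ∧' g) ∨' clashesOr ps g u

infixl 6 _∧EM_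

_∧EM_ : Form → List ℕ → Form
γ ∧EM []       = γ
γ ∧EM (p ∷ ps) = (γ ∧' (var p ∨' ¬' var p)) ∧EM ps

Inconsistent : Clause → Set
Inconsistent C = ∃[ p ] (p , true) ∈ C × (p , false) ∈ C

inconsistent? : ∀ C → Dec (Inconsistent C)
inconsistent? C = map′ fromAny toAny (any? (λ (p , s) → (s Bool.≟ true) ×-dec ((p , false) ∈? C)) C)
  where
  fromAny : Any (λ (p , s) → s ≡ true × (p , false) ∈ C) C → Inconsistent C
  fromAny found with find found
  ... | (p , true) , p∈ , refl , p̄∈ = p , p∈ , p̄∈
  toAny : Inconsistent C → Any (λ (p , s) → s ≡ true × (p , false) ∈ C) C
  toAny (p , p∈ , p̄∈) = lose p∈ (refl , p̄∈)

Mentions : Clause → ℕ → Set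
Mentions C p = (p , true) ∈ C ⊎ (p , false) ∈ C

-- Covers C true (var p ∨' ¬' var p) unfolds to Mentions C p.
Covers-∧EM⁻ : ∀ ps {C γ} → Covers C true (γ ∧EM ps) → Covers C true γ × (∀ p → p ∈ ps → Mentions C p)
Covers-∧EM⁻ []       c = c , λ _ ()
Covers-∧EM⁻ (q ∷ qs) c with Covers-∧EM⁻ qs c
... | (cγ , mentions-q) , mentions-qs =
  cγ , λ { _ (here refl) → mentions-q ; p (there p∈) → mentions-qs p p∈ }

-- Criteria for single-premise rules γ ⊢ φ: BDCriterion γ φ for BD∞, KCriterion γ φ for K∞,
-- the same criteria for γ ∧EM vars φ in place of γ for LP∞ and CL∞, and both KCriterion γ φ
-- and BDCriterion (γ ∧EM vars φ) φ for KO∞.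
BDCriterion : Form → Form → Set
BDCriterion γ φ = All (λ C → Covers C true φ) (dnf true γ)

KCriterion : Form → Form → Set
KCriterion γ φ = All (λ C → Inconsistent C ⊎ Covers C true φ) (dnf true γ)

BDCriterion? : ∀ γ φ → Dec (BDCriterion γ φ)
BDCriterion? γ φ = all? (λ C → covers? C true φ) (dnf true γ)

KCriterion? : ∀ γ φ → Dec (KCriterion γ φ)
KCriterion? γ φ = all? (λ C → inconsistent? C ⊎-dec covers? C true φ) (dnf true γ)

orderTheoreticLattice : DeMorganLattice → OrderLattice.Lattice 0ℓ 0ℓ 0ℓ
orderTheoreticLattice A = AlgebraicLatticeProperties.∨-∧-orderTheoreticLattice record
  { isLattice = record
    { isEquivalence = isEquivalence
    ; ∨-comm = ⊔-comm ; ∨-assoc = ⊔-assoc ; ∨-cong = cong₂ _⊔_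
    ; ∧-comm = ⊓-comm ; ∧-assoc = ⊓-assoc ; ∧-cong = cong₂ _⊓_
    ; absorptive = ⊔-absorbs-⊓ , ⊓-absorbs-⊔
    }
  }
  where open DeMorganLattice A

module DeMorganOrder (A : DeMorganLattice) (F : DeMorganLattice.Carrier A → Set)
                     (v : ℕ → DeMorganLattice.Carrier A) where
  open DeMorganLattice A hiding (_≤_) public
  open OrderLattice.Lattice (orderTheoreticLattice A) public
    using ()
    renaming ( _≤_ to _⊑_ ; refl to ⊑-refl ; trans to ⊑-trans ; reflexive to ≡⇒⊑
             ; x≤x∨y to x⊑x⊔y ; y≤x∨y to y⊑x⊔y ; ∨-least to ⊔-least
             ; x∧y≤x to x⊓y⊑x ; x∧y≤y to x⊓y⊑y ; ∧-greatest to ⊓-greatest )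

  E : Form → Carrier
  E = Structure.eval (toStructure A F) v

  ⊑⇒≤ : ∀ {x y} → x ⊑ y → x ⊓ y ≡ x
  ⊑⇒≤ = sym

  ⊔-monoˡ : ∀ {a a′ c} → a ⊑ a′ → a ⊔ c ⊑ a′ ⊔ c
  ⊔-monoˡ a⊑a′ = ⊔-least (⊑-trans a⊑a′ (x⊑x⊔y _ _)) (y⊑x⊔y _ _)

  ⊔-elim : ∀ {x a c u} → x ⊑ a ⊔ c → x ⊓ a ⊑ u → x ⊓ c ⊑ u → x ⊑ u
  ⊔-elim {x} {a} {c} x⊑a⊔c xa⊑u xc⊑u =
    subst (_⊑ _) (sym (trans x⊑a⊔c (⊓-distrib-⊔ x a c))) (⊔-least xa⊑u xc⊑u)

  infix 4 _⊑ᶜ_ _⊑⋁_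

  -- y ⊑ᶜ C says y ⊑ ⋀ C without forming the meet of a possibly empty clause.
  _⊑ᶜ_ : Carrier → Clause → Set
  y ⊑ᶜ C = ∀ ℓ → ℓ ∈ C → y ⊑ E (lit ℓ)

  -- a ⊑⋁ L says a ⊑ ⋁ { ⋀ C ∣ C ∈ L }, stated as an elimination principle for the same reason.
  _⊑⋁_ : Carrier → List Clause → Set
  a ⊑⋁ L = ∀ {x u} → x ⊑ a → (∀ C → C ∈ L → ∀ {y} → y ⊑ x → y ⊑ᶜ C → y ⊑ u) → x ⊑ u

  ⊑⋁-⊗ : ∀ {a c L L′} → a ⊑⋁ L → c ⊑⋁ L′ → a ⊓ c ⊑⋁ (L ⊗ L′)
  ⊑⋁-⊗ a⊑L c⊑L′ x⊑a⊓c below =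
    a⊑L (⊑-trans x⊑a⊓c (x⊓y⊑x _ _)) λ C C∈ y⊑x y⊑C →
      c⊑L′ (⊑-trans y⊑x (⊑-trans x⊑a⊓c (x⊓y⊑y _ _))) λ C′ C′∈ y′⊑y y′⊑C′ →
        below (C ++ C′) (∈-cartesianProductWith⁺ _++_ C∈ C′∈) (⊑-trans y′⊑y y⊑x) λ ℓ ℓ∈ →
          [ (λ ℓ∈C → ⊑-trans y′⊑y (y⊑C ℓ ℓ∈C)) , y′⊑C′ ℓ ]′ (∈-++⁻ C ℓ∈)

  ⊑⋁-++ : ∀ {a c L L′} → a ⊑⋁ L → c ⊑⋁ L′ → a ⊔ c ⊑⋁ (L ++ L′)
  ⊑⋁-++ {L = L} a⊑L c⊑L′ x⊑a⊔c below = ⊔-elim x⊑a⊔c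
    (a⊑L (x⊓y⊑y _ _) λ C C∈ y⊑ → below C (∈-++⁺ˡ C∈) (⊑-trans y⊑ (x⊓y⊑x _ _)))
    (c⊑L′ (x⊓y⊑y _ _) λ C C∈ y⊑ → below C (∈-++⁺ʳ L C∈) (⊑-trans y⊑ (x⊓y⊑x _ _)))

  ⊑⋁-dnf : ∀ s φ → E (polar s φ) ⊑⋁ dnf s φ
  ⊑⋁-dnf s (var p) x⊑ below = below _ (here refl) ⊑-refl λ { _ (here refl) → x⊑ }
  ⊑⋁-dnf true  (φ ∧' ψ) = ⊑⋁-⊗ (⊑⋁-dnf true φ) (⊑⋁-dnf true ψ)
  ⊑⋁-dnf false (φ ∧' ψ) =
    subst (_⊑⋁ _) (sym (neg-⊓ (E φ) (E ψ))) (⊑⋁-++ (⊑⋁-dnf false φ) (⊑⋁-dnf false ψ))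
  ⊑⋁-dnf true  (φ ∨' ψ) = ⊑⋁-++ (⊑⋁-dnf true φ) (⊑⋁-dnf true ψ)
  ⊑⋁-dnf false (φ ∨' ψ) =
    subst (_⊑⋁ _) (sym (neg-⊔ (E φ) (E ψ))) (⊑⋁-⊗ (⊑⋁-dnf false φ) (⊑⋁-dnf false ψ))
  ⊑⋁-dnf true  (¬' φ) = ⊑⋁-dnf false φ
  ⊑⋁-dnf false (¬' φ) = subst (_⊑⋁ _) (sym (neg-invol (E φ))) (⊑⋁-dnf true φ)

  Covers-⊑ : ∀ {C y} s φ → y ⊑ᶜ C → Covers C s φ → y ⊑ E (polar s φ)
  Covers-⊑ s (var p) y⊑C p∈C = y⊑C _ p∈C
  Covers-⊑ true (φ ∧' ψ) y⊑C (cφ , cψ) = ⊓-greatest (Covers-⊑ true φ y⊑C cφ) (Covers-⊑ true ψ y⊑C cψ)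
  Covers-⊑ false (φ ∧' ψ) y⊑C c = subst (_ ⊑_) (sym (neg-⊓ (E φ) (E ψ))) ([
    (λ cφ → ⊑-trans (Covers-⊑ false φ y⊑C cφ) (x⊑x⊔y _ _)) ,
    (λ cψ → ⊑-trans (Covers-⊑ false ψ y⊑C cψ) (y⊑x⊔y _ _)) ]′ c)
  Covers-⊑ true (φ ∨' ψ) y⊑C c = [
    (λ cφ → ⊑-trans (Covers-⊑ true φ y⊑C cφ) (x⊑x⊔y _ _)) ,
    (λ cψ → ⊑-trans (Covers-⊑ true ψ y⊑C cψ) (y⊑x⊔y _ _)) ]′ c
  Covers-⊑ false (φ ∨' ψ) y⊑C (cφ , cψ) = subst (_ ⊑_) (sym (neg-⊔ (E φ) (E ψ)))
    (⊓-greatest (Covers-⊑ false φ y⊑C cφ) (Covers-⊑ false ψ y⊑C cψ))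
  Covers-⊑ true  (¬' φ) y⊑C c = Covers-⊑ false φ y⊑C c
  Covers-⊑ false (¬' φ) y⊑C c = subst (_ ⊑_) (sym (neg-invol (E φ))) (Covers-⊑ true φ y⊑C c)

  BDCriterion⇒⊑ : ∀ γ φ → BDCriterion γ φ → E γ ⊑ E φ
  BDCriterion⇒⊑ γ φ crit = ⊑⋁-dnf true γ ⊑-refl λ C C∈ _ y⊑C → Covers-⊑ true φ y⊑C (All.lookup crit C∈)

  u⊑clashesOr : ∀ ps {g u} → E u ⊑ E (clashesOr ps g u)
  u⊑clashesOr []       = ⊑-refl
  u⊑clashesOr (p ∷ ps) = ⊑-trans (u⊑clashesOr ps) (y⊑x⊔y _ _)

  clash⊑clashesOr : ∀ {p ps g u} → p ∈ ps → E (clash p ∧' g) ⊑ E (clashesOr ps g u)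
  clash⊑clashesOr (here refl) = x⊑x⊔y _ _
  clash⊑clashesOr (there p∈)  = ⊑-trans (clash⊑clashesOr p∈) (y⊑x⊔y _ _)

  clashesOr-least : ∀ {ps g u w} → E u ⊑ w → (∀ p → p ∈ ps → E (clash p ∧' g) ⊑ w) →
    E (clashesOr ps g u) ⊑ w
  clashesOr-least {[]}     u⊑w _     = u⊑w
  clashesOr-least {p ∷ ps} u⊑w clashes⊑w =
    ⊔-least (clashes⊑w p (here refl)) (clashesOr-least u⊑w λ q → clashes⊑w q ∘ there)

  clashesOr-⊑ : ∀ ps g u → E g ⊑ E u → E (clashesOr ps g u) ⊑ E u
  clashesOr-⊑ ps g u g⊑u = clashesOr-least {ps} ⊑-refl λ _ _ → ⊑-trans (x⊓y⊑y _ _) g⊑u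

  clashesOr-∨ : ∀ ps {g c u} → E (clashesOr ps g (c ∨' u)) ≡ E (c ∨' clashesOr ps g u)
  clashesOr-∨ []       = refl
  clashesOr-∨ (p ∷ ps) {g} {c} {u} = begin
    P ⊔ E (clashesOr ps g (c ∨' u)) ≡⟨ cong (P ⊔_) (clashesOr-∨ ps) ⟩
    P ⊔ (E c ⊔ R)                    ≡⟨ sym (⊔-assoc P (E c) R) ⟩
    (P ⊔ E c) ⊔ R                    ≡⟨ cong (_⊔ R) (⊔-comm P (E c)) ⟩
    (E c ⊔ P) ⊔ R                    ≡⟨ ⊔-assoc (E c) P R ⟩
    E c ⊔ (P ⊔ R)                    ∎
    where
    open ≡-Reasoning
    P = E (clash p ∧' g)
    R = E (clashesOr ps g u)

  KCriterion⇒⊑ : ∀ γ φ → KCriterion γ φ → E γ ⊑ E (clashesOr (vars γ) γ φ)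
  KCriterion⇒⊑ γ φ crit = ⊑⋁-dnf true γ ⊑-refl below
    where
    below : ∀ C → C ∈ dnf true γ → ∀ {y} → y ⊑ E γ → y ⊑ᶜ C → y ⊑ E (clashesOr (vars γ) γ φ)
    below C C∈ y⊑γ y⊑C with All.lookup crit C∈
    ... | inj₂ covers        = ⊑-trans (Covers-⊑ true φ y⊑C covers) (u⊑clashesOr (vars γ))
    ... | inj₁ (p , p∈ , p̄∈) = ⊑-trans (⊓-greatest (⊓-greatest (y⊑C _ p∈) (y⊑C _ p̄∈)) y⊑γ)
                                       (clash⊑clashesOr (∈dnf⇒∈vars true γ C∈ p∈))

infix 4 _⊑ᴰᴹ_

_⊑ᴰᴹ_ : Form → Form → Set₁
γ ⊑ᴰᴹ φ = ∀ A F v → let open DeMorganOrder A F v in E γ ⊑ E φ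

⊑ᴰᴹ⇒BD∞ : ∀ {γ φ} → γ ⊑ᴰᴹ φ → BD∞ ⟦ γ ∷ [] ⟧ φ
⊑ᴰᴹ⇒BD∞ {γ} γ⊑φ A F up v hyp = up _ _ (DeMorganOrder.⊑⇒≤ A F v (γ⊑φ A F v)) (hyp γ (here refl))

eval₄ : (ℕ → DM4) → Form → DM4
eval₄ = Structure.eval 𝒟ℳ₁

-- Belnap's reading: p is told true iff p ∈ C, told false iff ¬p ∈ C; variables that C does
-- not mention get the value z.
clauseVal : DM4 → Clause → ℕ → DM4
clauseVal z C p with (p , true) ∈? C | (p , false) ∈? C
... | yes _ | yes _ = b
... | yes _ | no _  = t
... | no _  | yes _ = f
... | no _  | no _  = z

lit-designated : ∀ z C ℓ → ℓ ∈ C → D₁ (eval₄ (clauseVal z C) (lit ℓ))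
lit-designated z C (p , true) ℓ∈ with (p , true) ∈? C | (p , false) ∈? C
... | yes _ | yes _ = tt
... | yes _ | no _  = tt
... | no ∉  | _     = ⊥-elim (∉ ℓ∈)
lit-designated z C (p , false) ℓ∈ with (p , true) ∈? C | (p , false) ∈? C
... | yes _ | yes _ = tt
... | no _  | yes _ = tt
... | _     | no ∉  = ⊥-elim (∉ ℓ∈)

designated-lit : ∀ C ℓ → D₁ (eval₄ (clauseVal n C) (lit ℓ)) → ℓ ∈ C
designated-lit C (p , true) d with (p , true) ∈? C | (p , false) ∈? C
... | yes ∈ | _     = ∈
... | no _  | yes _ = ⊥-elim d
... | no _  | no _  = ⊥-elim d
designated-lit C (p , false) d with (p , true) ∈? C | (p , false) ∈? C
... | _     | yes ∈ = ∈
... | yes _ | no _  = ⊥-elim d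
... | no _  | no _  = ⊥-elim d

clauseVal-mentioned : ∀ z z′ C p → Mentions C p → clauseVal z C p ≡ clauseVal z′ C p
clauseVal-mentioned z z′ C p mentioned with (p , true) ∈? C | (p , false) ∈? C
... | yes _ | yes _ = refl
... | yes _ | no _  = refl
... | no _  | yes _ = refl
... | no ∉  | no ∉′ = ⊥-elim ([ ∉ , ∉′ ]′ mentioned)

clauseVal∈K : ∀ C → ¬ Inconsistent C → ∀ p → T (memK (clauseVal n C p))
clauseVal∈K C consistent p with (p , true) ∈? C | (p , false) ∈? C
... | yes p∈ | yes p̄∈ = ⊥-elim (consistent (p , p∈ , p̄∈))
... | yes _  | no _   = tt
... | no _   | yes _  = tt
... | no _   | no _   = tt

clauseVal∈P : ∀ C p → T (memP (clauseVal t C p))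
clauseVal∈P C p with (p , true) ∈? C | (p , false) ∈? C
... | yes _ | yes _ = tt
... | yes _ | no _  = tt
... | no _  | yes _ = tt
... | no _  | no _  = tt

clauseVal∈B : ∀ C → ¬ Inconsistent C → ∀ p → T (memB (clauseVal t C p))
clauseVal∈B C consistent p with (p , true) ∈? C | (p , false) ∈? C
... | yes p∈ | yes p̄∈ = ⊥-elim (consistent (p , p∈ , p̄∈))
... | yes _  | no _   = tt
... | no _   | yes _  = tt
... | no _   | no _   = tt

module _ (w : ℕ → DM4) where
  open DeMorganLattice DM4-lattice using (neg-⊓; neg-⊔; neg-invol)

  Covers⇒designated : ∀ {C} s φ → (∀ ℓ → ℓ ∈ C → D₁ (eval₄ w (lit ℓ))) →
    Covers C s φ → D₁ (eval₄ w (polar s φ))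
  Covers⇒designated s (var p) lits p∈C = lits _ p∈C
  Covers⇒designated true (φ ∧' ψ) lits (cφ , cψ) =
    D₁-∧⁺ _ _ (Covers⇒designated true φ lits cφ) (Covers⇒designated true ψ lits cψ)
  Covers⇒designated false (φ ∧' ψ) lits c = subst D₁ (sym (neg-⊓ (eval₄ w φ) (eval₄ w ψ)))
    (D₁-∨⁺ _ _ (Sum.map (Covers⇒designated false φ lits) (Covers⇒designated false ψ lits) c))
  Covers⇒designated true (φ ∨' ψ) lits c =
    D₁-∨⁺ _ _ (Sum.map (Covers⇒designated true φ lits) (Covers⇒designated true ψ lits) c)
  Covers⇒designated false (φ ∨' ψ) lits (cφ , cψ) = subst D₁ (sym (neg-⊔ (eval₄ w φ) (eval₄ w ψ)))
    (D₁-∧⁺ _ _ (Covers⇒designated false φ lits cφ) (Covers⇒designated false ψ lits cψ))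
  Covers⇒designated true  (¬' φ) lits c = Covers⇒designated false φ lits c
  Covers⇒designated false (¬' φ) lits c =
    subst D₁ (sym (neg-invol (eval₄ w φ))) (Covers⇒designated true φ lits c)

  designated⇒Covers : ∀ {C} s φ → (∀ ℓ → D₁ (eval₄ w (lit ℓ)) → ℓ ∈ C) →
    D₁ (eval₄ w (polar s φ)) → Covers C s φ
  designated⇒Covers s (var p) lits d = lits _ d
  designated⇒Covers true (φ ∧' ψ) lits d =
    let dφ , dψ = D₁-∧⁻ _ _ d in designated⇒Covers true φ lits dφ , designated⇒Covers true ψ lits dψ
  designated⇒Covers false (φ ∧' ψ) lits d =
    Sum.map (designated⇒Covers false φ lits) (designated⇒Covers false ψ lits)
      (D₁-∨⁻ _ _ (subst D₁ (neg-⊓ (eval₄ w φ) (eval₄ w ψ)) d))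
  designated⇒Covers true (φ ∨' ψ) lits d =
    Sum.map (designated⇒Covers true φ lits) (designated⇒Covers true ψ lits) (D₁-∨⁻ _ _ d)
  designated⇒Covers false (φ ∨' ψ) lits d =
    let dφ , dψ = D₁-∧⁻ _ _ (subst D₁ (neg-⊔ (eval₄ w φ) (eval₄ w ψ)) d) in
    designated⇒Covers false φ lits dφ , designated⇒Covers false ψ lits dψ
  designated⇒Covers true  (¬' φ) lits d = designated⇒Covers false φ lits d
  designated⇒Covers false (¬' φ) lits d = designated⇒Covers true φ lits (subst D₁ (neg-invol (eval₄ w φ)) d)

clause-countermodel : ∀ {γ φ C} → C ∈ dnf true γ → ¬ Covers C true φ → Countermodel 𝒟ℳ₁ ⟦ γ ∷ [] ⟧ φ
clause-countermodel {γ} {φ} {C} C∈ ¬covers = record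
  { valuation  = clauseVal n C
  ; designates = single (Covers⇒designated (clauseVal n C) true γ (lit-designated n C)
                                           (∈dnf⇒Covers true γ C∈))
  ; refutes    = ¬covers ∘ designated⇒Covers (clauseVal n C) true φ (designated-lit C)
  }

-- Completing the clause valuation by t is harmless for φ, since C mentions every variable of φ.
clause-countermodel⁺ : ∀ {γ φ C} → C ∈ dnf true (γ ∧EM vars φ) → ¬ Covers C true φ →
  Countermodel 𝒟ℳ₁ ⟦ γ ∷ [] ⟧ φ
clause-countermodel⁺ {γ} {φ} {C} C∈ ¬covers = record
  { valuation  = clauseVal t C
  ; designates = single (Covers⇒designated (clauseVal t C) true γ (lit-designated t C) covers-γ)
  ; refutes    = Countermodel.refutes (clause-countermodel {γ ∧EM vars φ} {φ} C∈ ¬covers)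
               ∘ subst D₁ (eval-cong 𝒟ℳ₁ φ λ p → clauseVal-mentioned t n C p ∘ mentions p)
  }
  where
  covers-γ : Covers C true γ
  covers-γ = proj₁ (Covers-∧EM⁻ (vars φ) (∈dnf⇒Covers true (γ ∧EM vars φ) C∈))
  mentions : ∀ p → p ∈ vars φ → Mentions C p
  mentions = proj₂ (Covers-∧EM⁻ (vars φ) (∈dnf⇒Covers true (γ ∧EM vars φ) C∈))

failing-clause : ∀ {P : Clause → Set} → Decidable P → ∀ L → ¬ All P L → ∃[ C ] C ∈ L × ¬ P C
failing-clause P? L ¬all = find (¬All⇒Any¬ P? L ¬all)

countermodel-𝒟ℳ₁ : ∀ γ φ → ¬ BDCriterion γ φ → Countermodel 𝒟ℳ₁ ⟦ γ ∷ [] ⟧ φ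
countermodel-𝒟ℳ₁ γ φ ¬crit =
  let C , C∈ , ¬covers = failing-clause (λ C → covers? C true φ) (dnf true γ) ¬crit in
  clause-countermodel C∈ ¬covers

countermodel-𝒫₁ : ∀ γ φ → ¬ BDCriterion (γ ∧EM vars φ) φ → Countermodel 𝒫₁ ⟦ γ ∷ [] ⟧ φ
countermodel-𝒫₁ γ φ ¬crit =
  let C , C∈ , ¬covers = failing-clause (λ C → covers? C true φ) (dnf true (γ ∧EM vars φ)) ¬crit in
  Countermodel-Sub SubP (clause-countermodel⁺ C∈ ¬covers) (clauseVal∈P C)

countermodel-𝒦₁ : ∀ γ φ → ¬ KCriterion γ φ → Countermodel 𝒦₁ ⟦ γ ∷ [] ⟧ φ
countermodel-𝒦₁ γ φ ¬crit =
  let C , C∈ , ¬ok = failing-clause (λ C → inconsistent? C ⊎-dec covers? C true φ) (dnf true γ) ¬crit in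
  Countermodel-Sub SubK (clause-countermodel C∈ (¬ok ∘ inj₂)) (clauseVal∈K C (¬ok ∘ inj₁))

countermodel-ℬ₁ : ∀ γ φ → ¬ KCriterion (γ ∧EM vars φ) φ → Countermodel ℬ₁ ⟦ γ ∷ [] ⟧ φ
countermodel-ℬ₁ γ φ ¬crit =
  let C , C∈ , ¬ok = failing-clause (λ C → inconsistent? C ⊎-dec covers? C true φ)
                                    (dnf true (γ ∧EM vars φ)) ¬crit in
  Countermodel-Sub SubB (clause-countermodel⁺ C∈ (¬ok ∘ inj₂)) (clauseVal∈B C (¬ok ∘ inj₁))

eval₄-n : ∀ φ → eval₄ (λ _ → n) φ ≡ n
eval₄-n (var _)  = refl
eval₄-n (φ ∧' ψ) = cong₂ _∧₄_ (eval₄-n φ) (eval₄-n ψ)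
eval₄-n (φ ∨' ψ) = cong₂ _∨₄_ (eval₄-n φ) (eval₄-n ψ)
eval₄-n (¬' φ)   = cong ¬₄ (eval₄-n φ)

countermodel₀-𝒟ℳ₁ : ∀ φ → Countermodel 𝒟ℳ₁ ⟦ [] ⟧ φ
countermodel₀-𝒟ℳ₁ φ = record
  { valuation = λ _ → n ; designates = λ _ () ; refutes = subst D₁ (eval₄-n φ) }

countermodel₀-𝒦₁ : ∀ φ → Countermodel 𝒦₁ ⟦ [] ⟧ φ
countermodel₀-𝒦₁ φ = Countermodel-Sub SubK (countermodel₀-𝒟ℳ₁ φ) λ _ → tt

Monotone : Rel → Set₁
Monotone Λ = ∀ Γ Δ φ → (∀ ψ → Γ ψ → Δ ψ) → Λ Γ φ → Λ Δ φ

BD∞-mono : Monotone BD∞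
BD∞-mono _ _ _ Γ⊆Δ d A F up v hyp = d A F up v λ ψ → hyp ψ ∘ Γ⊆Δ ψ

Extension-mono : ∀ {Base R} → Monotone (Extension Base R)
Extension-mono _ _ _ Γ⊆Δ d L L-logic Base⊆L rules =
  IsLogic.monotone L-logic _ _ _ Γ⊆Δ (d L L-logic Base⊆L rules)

Extension-cut : ∀ {Base R Δ ψ φ} →
  Extension Base R Δ ψ → Extension Base R ⟦ ψ ∷ [] ⟧ φ → Extension Base R Δ φ
Extension-cut Δ⊢ψ ψ⊢φ L L-logic Base⊆L rules =
  IsLogic.cut L-logic _ _ _ (single (Δ⊢ψ L L-logic Base⊆L rules)) (ψ⊢φ L L-logic Base⊆L rules)

assign : Form → Form → Form → Form → Subst
assign φx _  _  _  0 = φx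
assign _  φy _  _  1 = φy
assign _  _  φz _  2 = φz
assign _  _  _  φu 3 = φu
assign _  _  _  _  i = var i

module Derivations (L : FSet → Form → Set) (L-logic : IsLogic L) (BD∞⊆L : ∀ Γ φ → BD∞ Γ φ → L Γ φ) where
  open IsLogic L-logic

  infix  3 _⊢₁_
  infixr 2 _⨾_

  _⊢₁_ : Form → Form → Set
  γ ⊢₁ φ = L ⟦ γ ∷ [] ⟧ φ

  ⊢-refl : ∀ {φ} → φ ⊢₁ φ
  ⊢-refl = reflexive _ _ (here refl)

  _⨾_ : ∀ {Δ ψ φ} → L Δ ψ → ψ ⊢₁ φ → L Δ φ
  Δ⊢ψ ⨾ ψ⊢φ = cut _ _ _ (single Δ⊢ψ) ψ⊢φ

  ⊑ᴰᴹ⇒⊢ : ∀ {γ φ} → γ ⊑ᴰᴹ φ → γ ⊢₁ φ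
  ⊑ᴰᴹ⇒⊢ {γ} {φ} γ⊑φ = BD∞⊆L _ _ (⊑ᴰᴹ⇒BD∞ {γ} {φ} γ⊑φ)

  instantiate : ∀ {Δ φ} → L ⟦ Δ ⟧ φ → ∀ σ → L ⟦ map (sub σ) Δ ⟧ (sub σ φ)
  instantiate Δ⊢φ σ =
    monotone _ _ _ (λ { _ (χ , χ∈Δ , refl) → ∈-map⁺ (sub σ) χ∈Δ }) (structural σ _ _ Δ⊢φ)

  module _ (lp : x ⊢₁ x ∧' (y ∨' ¬' y)) where

    ⊢-∧EM : ∀ ps {γ} → γ ⊢₁ γ ∧EM ps
    ⊢-∧EM []           = ⊢-refl
    ⊢-∧EM (p ∷ ps) {γ} = instantiate lp (assign γ (var p) γ γ) ⨾ ⊢-∧EM ps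

  module _ (k : (x ∧' ¬' x) ∨' y ⊢₁ y) where

    clashesOr-⊢ : ∀ ps {g u} → clashesOr ps g u ⊢₁ u
    clashesOr-⊢ []               = ⊢-refl
    clashesOr-⊢ (p ∷ ps) {g} {u} =
      ⊑ᴰᴹ⇒⊢ (λ A F v → DeMorganOrder.⊔-monoˡ A F v (DeMorganOrder.x⊓y⊑x A F v _ _))
      ⨾ instantiate k (assign (var p) (clashesOr ps g u) x x)
      ⨾ clashesOr-⊢ ps

  module _ (ko : ((x ∧' ¬' x) ∧' z) ∨' u ⊢₁ ((y ∨' ¬' y) ∧' z) ∨' u) where

    clash-∧EM : ∀ qs {p g w} → (clash p ∧' g) ∨' w ⊢₁ (clash p ∧' (g ∧EM qs)) ∨' w
    clash-∧EM []                 = ⊢-refl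
    clash-∧EM (q ∷ qs) {p} {g} {w} =
      ⊑ᴰᴹ⇒⊢ duplicate
      ⨾ instantiate ko (assign (var p) (var q) (clash p ∧' g) w)
      ⨾ ⊑ᴰᴹ⇒⊢ regroup
      ⨾ clash-∧EM qs
      where
      duplicate : (clash p ∧' g) ∨' w ⊑ᴰᴹ (clash p ∧' (clash p ∧' g)) ∨' w
      duplicate A F v = ⊔-monoˡ (⊓-greatest (x⊓y⊑x _ _) ⊑-refl)
        where open DeMorganOrder A F v
      regroup : ((var q ∨' ¬' var q) ∧' (clash p ∧' g)) ∨' w
                ⊑ᴰᴹ (clash p ∧' (g ∧' (var q ∨' ¬' var q))) ∨' w
      regroup A F v = ⊔-monoˡ (⊓-greatest (⊑-trans (x⊓y⊑y _ _) (x⊓y⊑x _ _))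
                                          (⊓-greatest (⊑-trans (x⊓y⊑y _ _) (x⊓y⊑y _ _)) (x⊓y⊑x _ _)))
        where open DeMorganOrder A F v

    clashesOr-∧EM : ∀ ps qs {g w} → clashesOr ps g w ⊢₁ clashesOr ps (g ∧EM qs) w
    clashesOr-∧EM []       qs = ⊢-refl
    clashesOr-∧EM (p ∷ ps) qs {g} {w} =
      clash-∧EM qs ⨾ ⊑ᴰᴹ⇒⊢ pull ⨾ clashesOr-∧EM ps qs ⨾ ⊑ᴰᴹ⇒⊢ push
      where
      c : Form
      c = clash p ∧' (g ∧EM qs)
      pull : c ∨' clashesOr ps g w ⊑ᴰᴹ clashesOr ps g (c ∨' w)
      pull A F v = ≡⇒⊑ (sym (clashesOr-∨ ps {g} {c} {w}))
        where open DeMorganOrder A F v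
      push : clashesOr ps (g ∧EM qs) (c ∨' w) ⊑ᴰᴹ c ∨' clashesOr ps (g ∧EM qs) w
      push A F v = ≡⇒⊑ (clashesOr-∨ ps {g ∧EM qs} {c} {w})
        where open DeMorganOrder A F v

BD-derivation : ∀ γ φ → BDCriterion γ φ → BD∞ ⟦ γ ∷ [] ⟧ φ
BD-derivation γ φ crit = ⊑ᴰᴹ⇒BD∞ {γ} {φ} λ A F v → DeMorganOrder.BDCriterion⇒⊑ A F v γ φ crit

LP-derivation : ∀ γ φ → BDCriterion (γ ∧EM vars φ) φ → LP∞ ⟦ γ ∷ [] ⟧ φ
LP-derivation γ φ crit L L-logic BD∞⊆L rules =
  ⊢-∧EM (rules rule-lp (there (here refl))) (vars φ) ⨾ BD∞⊆L _ _ (BD-derivation (γ ∧EM vars φ) φ crit)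
  where open Derivations L L-logic BD∞⊆L

K-derivation : ∀ γ φ → KCriterion γ φ → K∞ ⟦ γ ∷ [] ⟧ φ
K-derivation γ φ crit L L-logic BD∞⊆L rules =
  ⊑ᴰᴹ⇒⊢ (λ A F v → DeMorganOrder.KCriterion⇒⊑ A F v γ φ crit)
  ⨾ clashesOr-⊢ (rules rule-k (here refl)) (vars γ)
  where open Derivations L L-logic BD∞⊆L

CL-derivation : ∀ γ φ → KCriterion (γ ∧EM vars φ) φ → CL∞ ⟦ γ ∷ [] ⟧ φ
CL-derivation γ φ crit L L-logic BD∞⊆L rules =
  ⊢-∧EM (rules rule-lp (there (here refl))) (vars φ)
  ⨾ ⊑ᴰᴹ⇒⊢ (λ A F v → DeMorganOrder.KCriterion⇒⊑ A F v (γ ∧EM vars φ) φ crit)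
  ⨾ clashesOr-⊢ (rules rule-k (there (there (here refl)))) (vars (γ ∧EM vars φ))
  where open Derivations L L-logic BD∞⊆L

KO-derivation : ∀ γ φ → KCriterion γ φ → BDCriterion (γ ∧EM vars φ) φ → KO∞ ⟦ γ ∷ [] ⟧ φ
KO-derivation γ φ kcrit bdcrit L L-logic BD∞⊆L rules =
  ⊑ᴰᴹ⇒⊢ (λ A F v → DeMorganOrder.KCriterion⇒⊑ A F v γ φ kcrit)
  ⨾ clashesOr-∧EM (rules rule-ko (here refl)) (vars γ) (vars φ)
  ⨾ ⊑ᴰᴹ⇒⊢ (λ A F v → DeMorganOrder.clashesOr-⊑ A F v (vars γ) (γ ∧EM vars φ) φ
                                     (DeMorganOrder.BDCriterion⇒⊑ A F v (γ ∧EM vars φ) φ bdcrit))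
  where open Derivations L L-logic BD∞⊆L

BD-dichotomy : ∀ γ φ → BD∞ ⟦ γ ∷ [] ⟧ φ ⊎ Countermodel 𝒟ℳ₁ ⟦ γ ∷ [] ⟧ φ
BD-dichotomy γ φ = Sum.map (BD-derivation γ φ) (countermodel-𝒟ℳ₁ γ φ) (toSum (BDCriterion? γ φ))

LP-dichotomy : ∀ γ φ → LP∞ ⟦ γ ∷ [] ⟧ φ ⊎ Countermodel 𝒫₁ ⟦ γ ∷ [] ⟧ φ
LP-dichotomy γ φ =
  Sum.map (LP-derivation γ φ) (countermodel-𝒫₁ γ φ) (toSum (BDCriterion? (γ ∧EM vars φ) φ))

K-dichotomy : ∀ γ φ → K∞ ⟦ γ ∷ [] ⟧ φ ⊎ Countermodel 𝒦₁ ⟦ γ ∷ [] ⟧ φ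
K-dichotomy γ φ = Sum.map (K-derivation γ φ) (countermodel-𝒦₁ γ φ) (toSum (KCriterion? γ φ))

CL-dichotomy : ∀ γ φ → CL∞ ⟦ γ ∷ [] ⟧ φ ⊎ Countermodel ℬ₁ ⟦ γ ∷ [] ⟧ φ
CL-dichotomy γ φ =
  Sum.map (CL-derivation γ φ) (countermodel-ℬ₁ γ φ) (toSum (KCriterion? (γ ∧EM vars φ) φ))

KO-dichotomy : ∀ γ φ → KO∞ ⟦ γ ∷ [] ⟧ φ ⊎ (Countermodel 𝒫₁ ⟦ γ ∷ [] ⟧ φ ⊎ Countermodel 𝒦₁ ⟦ γ ∷ [] ⟧ φ)
KO-dichotomy γ φ with KCriterion? γ φ | BDCriterion? (γ ∧EM vars φ) φ
... | yes kcrit | yes bdcrit = inj₁ (KO-derivation γ φ kcrit bdcrit)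
... | no ¬kcrit | _          = inj₂ (inj₂ (countermodel-𝒦₁ γ φ ¬kcrit))
... | _         | no ¬bdcrit = inj₂ (inj₁ (countermodel-𝒫₁ γ φ ¬bdcrit))

LP-dichotomy₀ : ∀ φ → LP∞ ⟦ [] ⟧ φ ⊎ Countermodel 𝒫₁ ⟦ [] ⟧ φ
LP-dichotomy₀ φ = Sum.map (Extension-cut λ _ _ _ rules → rules rule-em (here refl))
                          (Countermodel-antitone λ _ ())
                          (LP-dichotomy (x ∨' ¬' x) φ)

CL-dichotomy₀ : ∀ φ → CL∞ ⟦ [] ⟧ φ ⊎ Countermodel ℬ₁ ⟦ [] ⟧ φ
CL-dichotomy₀ φ = Sum.map (Extension-cut λ _ _ _ rules → rules rule-em (here refl))
                          (Countermodel-antitone λ _ ())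
                          (CL-dichotomy (x ∨' ¬' x) φ)

premise-index : ∀ {Γ γ} → γ ∈ Γ → Σ[ k ∈ Fin (length Γ) ] ⟦ lookup Γ k ∷ [] ⟧ γ
premise-index γ∈Γ = index γ∈Γ , here (lookup-index γ∈Γ)

Slot : (Γ : List Form) → Fin (suc (length Γ)) → FSet
Slot Γ zero    = ⟦ [] ⟧
Slot Γ (suc k) = ⟦ lookup Γ k ∷ [] ⟧

slot-countermodel : ∀ {M Γ φ} → Countermodel M ⟦ [] ⟧ φ → All (λ γ → Countermodel M ⟦ γ ∷ [] ⟧ φ) Γ →
  ∀ k → Countermodel M (Slot Γ k) φ
slot-countermodel c₀ cs zero    = c₀
slot-countermodel c₀ cs (suc k) = All.lookup cs (∈-lookup k)

slot-index : ∀ {Γ γ} → γ ∈ Γ → ∃[ k ] Slot Γ k γ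
slot-index γ∈Γ = let k , γ∈ = premise-index γ∈Γ in suc k , γ∈

DualPower-countermodel : ∀ {M Γ φ} → Countermodel M ⟦ [] ⟧ φ →
  All (λ γ → Countermodel M ⟦ γ ∷ [] ⟧ φ) Γ → Countermodel (DualPower M (suc (length Γ))) ⟦ Γ ⟧ φ
DualPower-countermodel {M} c₀ cs =
  DualProduct-countermodel (λ _ → M) (slot-countermodel c₀ cs) λ _ → slot-index

𝒫⊗𝒦-countermodel : ∀ {Γ Γ₁ Γ₂ φ} → Countermodel 𝒦₁ ⟦ [] ⟧ φ →
  All (λ γ → Countermodel 𝒫₁ ⟦ γ ∷ [] ⟧ φ) Γ₁ → All (λ γ → Countermodel 𝒦₁ ⟦ γ ∷ [] ⟧ φ) Γ₂ →
  (∀ {γ} → γ ∈ Γ → γ ∈ Γ₁ ⊎ γ ∈ Γ₂) → Countermodel (𝒫⊗𝒦 (length Γ₁) (suc (length Γ₂))) ⟦ Γ ⟧ φ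
𝒫⊗𝒦-countermodel {Γ} {Γ₁} {Γ₂} {φ} c₀ ps ks split =
  DualProduct-countermodel 𝒫|𝒦 {Δ = Δ} countermodel cover
  where
  Δ : Fin (length Γ₁) ⊎ Fin (suc (length Γ₂)) → FSet
  Δ = Sum.[ (λ k → ⟦ lookup Γ₁ k ∷ [] ⟧) , Slot Γ₂ ]
  countermodel : ∀ k → Countermodel (𝒫|𝒦 k) (Δ k) φ
  countermodel (inj₁ k) = All.lookup ps (∈-lookup k)
  countermodel (inj₂ k) = slot-countermodel c₀ ks k
  cover : ∀ γ → γ ∈ Γ → ∃[ k ] Δ k γ
  cover γ γ∈Γ = [ (λ γ∈Γ₁ → let k , γ∈ = premise-index γ∈Γ₁ in inj₁ k , γ∈)
                    , (λ γ∈Γ₂ → let k , γ∈ = slot-index γ∈Γ₂ in inj₂ k , γ∈) ]′ (split γ∈Γ)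

partition : ∀ {A B : Form → Set} {Γ} → All (λ γ → A γ ⊎ B γ) Γ →
  ∃[ Γ₁ ] ∃[ Γ₂ ] All A Γ₁ × All B Γ₂ × (∀ {γ} → γ ∈ Γ → γ ∈ Γ₁ ⊎ γ ∈ Γ₂)
partition [] = [] , [] , [] , [] , λ ()
partition {Γ = γ ∷ Γ} (inj₁ Aγ ∷ abs) =
  let Γ₁ , Γ₂ , as , bs , split = partition abs in
  γ ∷ Γ₁ , Γ₂ , Aγ ∷ as , bs , λ { (here refl) → inj₁ (here refl) ; (there γ∈) → Sum.map₁ there (split γ∈) }
partition {Γ = γ ∷ Γ} (inj₂ Bγ ∷ abs) =
  let Γ₁ , Γ₂ , as , bs , split = partition abs in
  Γ₁ , γ ∷ Γ₂ , as , Bγ ∷ bs , λ { (here refl) → inj₂ (here refl) ; (there γ∈) → Sum.map₂ there (split γ∈) }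

module _ {Λ : Rel} (Λ-mono : Monotone Λ) where

  derivable-or-refuted : ∀ {R : Form → Set} {φ} → (∀ γ → Λ ⟦ γ ∷ [] ⟧ φ ⊎ R γ) → ∀ Γ → Λ ⟦ Γ ⟧ φ ⊎ All R Γ
  derivable-or-refuted dichotomy [] = inj₂ []
  derivable-or-refuted dichotomy (γ ∷ Γ) with dichotomy γ | derivable-or-refuted dichotomy Γ
  ... | inj₁ d | _       = inj₁ (Λ-mono _ _ _ (single (here refl)) d)
  ... | inj₂ _ | inj₁ d  = inj₁ (Λ-mono _ _ _ (λ _ → there) d)
  ... | inj₂ r | inj₂ rs = inj₂ (r ∷ rs)

  complete-DualPower : ∀ {M} → (∀ φ → Λ ⟦ [] ⟧ φ ⊎ Countermodel M ⟦ [] ⟧ φ) →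
    (∀ γ φ → Λ ⟦ γ ∷ [] ⟧ φ ⊎ Countermodel M ⟦ γ ∷ [] ⟧ φ) →
    ∀ Γ φ → (∀ m → 1 ≤ m → ValidIn (DualPower M m) ⟦ Γ ⟧ φ) → Λ ⟦ Γ ⟧ φ
  complete-DualPower dichotomy₀ dichotomy Γ φ valid
    with dichotomy₀ φ | derivable-or-refuted (λ γ → dichotomy γ φ) Γ
  ... | inj₁ d  | _       = Λ-mono _ _ _ (λ _ ()) d
  ... | inj₂ _  | inj₁ d  = d
  ... | inj₂ c₀ | inj₂ cs =
    ⊥-elim (Countermodel⇒¬ValidIn (DualPower-countermodel c₀ cs) (valid _ (s≤s z≤n)))

  complete-𝒫⊗𝒦 : (∀ φ → Λ ⟦ [] ⟧ φ ⊎ Countermodel 𝒦₁ ⟦ [] ⟧ φ) →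
    (∀ γ φ → Λ ⟦ γ ∷ [] ⟧ φ ⊎ (Countermodel 𝒫₁ ⟦ γ ∷ [] ⟧ φ ⊎ Countermodel 𝒦₁ ⟦ γ ∷ [] ⟧ φ)) →
    ∀ Γ φ → (∀ i j → 1 ≤ i + j → ValidIn (𝒫⊗𝒦 i j) ⟦ Γ ⟧ φ) → Λ ⟦ Γ ⟧ φ
  complete-𝒫⊗𝒦 dichotomy₀ dichotomy Γ φ valid
    with dichotomy₀ φ | derivable-or-refuted (λ γ → dichotomy γ φ) Γ
  ... | inj₁ d  | _       = Λ-mono _ _ _ (λ _ ()) d
  ... | inj₂ _  | inj₁ d  = d
  ... | inj₂ c₀ | inj₂ cs =
    let Γ₁ , Γ₂ , ps , ks , split = partition cs in
    ⊥-elim (Countermodel⇒¬ValidIn (𝒫⊗𝒦-countermodel c₀ ps ks split)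
                                  (valid _ _ (≤-trans (s≤s z≤n) (m≤n+m _ (length Γ₁)))))

module _ (S : SubUniverse) where
  open SubUniverse S using (mem)

  em-valid : (∀ a → T (mem a) → D₁ (a ∨₄ ¬₄ a)) → ValidIn (Sub𝒟ℳ₁ S) ⟦ [] ⟧ (x ∨' ¬' x)
  em-valid holds v _ = holds (proj₁ (v 0)) (proj₂ (v 0))

  lp-valid : (∀ a c → T (mem c) → D₁ a → D₁ (a ∧₄ (c ∨₄ ¬₄ c))) →
    ValidIn (Sub𝒟ℳ₁ S) ⟦ x ∷ [] ⟧ (x ∧' (y ∨' ¬' y))
  lp-valid holds v hyp = holds _ (proj₁ (v 1)) (proj₂ (v 1)) (hyp x (here refl))

  k-valid : (∀ a c → T (mem a) → D₁ ((a ∧₄ ¬₄ a) ∨₄ c) → D₁ c) →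
    ValidIn (Sub𝒟ℳ₁ S) ⟦ ((x ∧' ¬' x) ∨' y) ∷ [] ⟧ y
  k-valid holds v hyp = holds (proj₁ (v 0)) _ (proj₂ (v 0)) (hyp _ (here refl))

  ko-valid :
    (∀ a c d e → T (mem a) → T (mem c) → D₁ (((a ∧₄ ¬₄ a) ∧₄ d) ∨₄ e) → D₁ (((c ∨₄ ¬₄ c) ∧₄ d) ∨₄ e)) →
    ValidIn (Sub𝒟ℳ₁ S) ⟦ Rule.premises rule-ko ⟧ (Rule.conclusion rule-ko)
  ko-valid holds v hyp =
    holds (proj₁ (v 0)) (proj₁ (v 1)) _ _ (proj₂ (v 0)) (proj₂ (v 1)) (hyp _ (here refl))

LP∞-sound : ∀ {Γ φ} → LP∞ Γ φ → ∀ m → 1 ≤ m → ValidIn (𝒫 m) Γ φ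
LP∞-sound d (suc m) _ = d _ (ValidIn-isLogic (𝒫 (suc m))) (BD∞-sound-Sub SubP (suc m)) rules
  where
  rules : ∀ r → r ∈ rule-em ∷ rule-lp ∷ [] → ValidIn (𝒫 (suc m)) ⟦ Rule.premises r ⟧ (Rule.conclusion r)
  rules _ (here refl) = DualProduct-valid₀ (λ _ → 𝒫₁) {φ = x ∨' ¬' x} zero λ _ →
    em-valid SubP (toWitness {a? = ∀₄? λ _ → T? _ →-dec D₁? _} tt)
  rules _ (there (here refl)) = DualProduct-valid₁ (λ _ → 𝒫₁) {φ = Rule.conclusion rule-lp} λ _ →
    lp-valid SubP (toWitness {a? = ∀₄²? λ _ _ → T? _ →-dec D₁? _ →-dec D₁? _} tt)

K∞-sound : ∀ {Γ φ} → K∞ Γ φ → ∀ m → 1 ≤ m → ValidIn (𝒦 m) Γ φ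
K∞-sound d m _ = d _ (ValidIn-isLogic (𝒦 m)) (BD∞-sound-Sub SubK m) rules
  where
  rules : ∀ r → r ∈ rule-k ∷ [] → ValidIn (𝒦 m) ⟦ Rule.premises r ⟧ (Rule.conclusion r)
  rules _ (here refl) = DualProduct-valid₁ (λ _ → 𝒦₁) {φ = y} λ _ →
    k-valid SubK (toWitness {a? = ∀₄²? λ _ _ → T? _ →-dec D₁? _ →-dec D₁? _} tt)

CL∞-sound : ∀ {Γ φ} → CL∞ Γ φ → ∀ m → 1 ≤ m → ValidIn (ℬ m) Γ φ
CL∞-sound d (suc m) _ = d _ (ValidIn-isLogic (ℬ (suc m))) (BD∞-sound-Sub SubB (suc m)) rules
  where
  rules : ∀ r → r ∈ rule-em ∷ rule-lp ∷ rule-k ∷ [] →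
    ValidIn (ℬ (suc m)) ⟦ Rule.premises r ⟧ (Rule.conclusion r)
  rules _ (here refl) = DualProduct-valid₀ (λ _ → ℬ₁) {φ = x ∨' ¬' x} zero λ _ →
    em-valid SubB (toWitness {a? = ∀₄? λ _ → T? _ →-dec D₁? _} tt)
  rules _ (there (here refl)) = DualProduct-valid₁ (λ _ → ℬ₁) {φ = Rule.conclusion rule-lp} λ _ →
    lp-valid SubB (toWitness {a? = ∀₄²? λ _ _ → T? _ →-dec D₁? _ →-dec D₁? _} tt)
  rules _ (there (there (here refl))) = DualProduct-valid₁ (λ _ → ℬ₁) {φ = y} λ _ →
    k-valid SubB (toWitness {a? = ∀₄²? λ _ _ → T? _ →-dec D₁? _ →-dec D₁? _} tt)

KO∞-sound : ∀ {Γ φ} → KO∞ Γ φ → ∀ i j → 1 ≤ i + j → ValidIn (𝒫⊗𝒦 i j) Γ φ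
KO∞-sound d i j _ = d _ (ValidIn-isLogic (𝒫⊗𝒦 i j)) (BD∞-sound-𝒫⊗𝒦 i j) rules
  where
  rules : ∀ r → r ∈ rule-ko ∷ [] → ValidIn (𝒫⊗𝒦 i j) ⟦ Rule.premises r ⟧ (Rule.conclusion r)
  rules _ (here refl) = DualProduct-valid₁ 𝒫|𝒦 {φ = Rule.conclusion rule-ko} λ
    { (inj₁ _) → ko-valid SubP
        (toWitness {a? = ∀₄? λ _ → ∀₄³? λ _ _ _ → T? _ →-dec T? _ →-dec D₁? _ →-dec D₁? _} tt)
    ; (inj₂ _) → ko-valid SubK
        (toWitness {a? = ∀₄? λ _ → ∀₄³? λ _ _ _ → T? _ →-dec T? _ →-dec D₁? _ →-dec D₁? _} tt)
    }

mainTheorem9 : (∀ (Γ : List Form) (φ : Form) →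
    BD∞ ⟦ Γ ⟧ φ ⇔ (∀ (m : ℕ) → 1 ≤ m → ValidIn (𝒟ℳ m) ⟦ Γ ⟧ φ))
    × (∀ (Γ : List Form) (φ : Form) →
    LP∞ ⟦ Γ ⟧ φ ⇔ (∀ (m : ℕ) → 1 ≤ m → ValidIn (𝒫 m) ⟦ Γ ⟧ φ))
    × (∀ (Γ : List Form) (φ : Form) →
    K∞ ⟦ Γ ⟧ φ ⇔ (∀ (m : ℕ) → 1 ≤ m → ValidIn (𝒦 m) ⟦ Γ ⟧ φ))
    × (∀ (Γ : List Form) (φ : Form) →
    CL∞ ⟦ Γ ⟧ φ ⇔ (∀ (m : ℕ) → 1 ≤ m → ValidIn (ℬ m) ⟦ Γ ⟧ φ))
    × (∀ (Γ : List Form) (φ : Form) →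
    KO∞ ⟦ Γ ⟧ φ ⇔ (∀ (i j : ℕ) → 1 ≤ i + j → ValidIn (𝒫⊗𝒦 i j) ⟦ Γ ⟧ φ))
mainTheorem9 =
    (λ Γ φ → mk⇔ (λ d m _ → BD∞-sound-𝒟ℳ m ⟦ Γ ⟧ φ d)
                 (complete-DualPower {BD∞} BD∞-mono (inj₂ ∘ countermodel₀-𝒟ℳ₁) BD-dichotomy Γ φ))
  , (λ Γ φ → mk⇔ LP∞-sound (complete-DualPower {LP∞} Extension-mono LP-dichotomy₀ LP-dichotomy Γ φ))
  , (λ Γ φ → mk⇔ K∞-sound
                 (complete-DualPower {K∞} Extension-mono (inj₂ ∘ countermodel₀-𝒦₁) K-dichotomy Γ φ))
  , (λ Γ φ → mk⇔ CL∞-sound (complete-DualPower {CL∞} Extension-mono CL-dichotomy₀ CL-dichotomy Γ φ))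
  , (λ Γ φ → mk⇔ KO∞-sound
                 (complete-𝒫⊗𝒦 {KO∞} Extension-mono (inj₂ ∘ countermodel₀-𝒦₁) KO-dichotomy Γ φ))
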